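{- For any stable matching instance with rotation poset $\Pi$, $$\mathsf{Depth}_{\Phi_{\mathsf{rot}}}(\mathsf{Spec}_{\mathsf{SM}})=\mathrm{height}(\Pi),$$ where $\mathrm{height}(\Pi)$ is the length (number of elements) of the longest chain in $\Pi$.
   Context: A stable matching instance has two disjoint sets of $n$ agents with complete preference lists; $\mathsf{Spec}_{\mathsf{SM}}$ is the offline specification whose admissible set is the set of all stable matchings of the instance. A rotation is a cyclic sequence $(a_0,b_0),\ldots,(a_{r-1},b_{r-1})$ of matched pairs in some stable matching such that $b_{i+1 \bmod r}$ is the next partner on $a_i$'s list after $b_i$ with whom $a_i$ appears in some stable matching; rotations, ordered by precedence ($\rho\prec\rho'$ if $\rho$ must be applied before $\rho'$ can be exposed), form the rotation poset $\Pi$, and downsets of $\Pi$ are in bijection with stable matchings; write $\mathsf{ds}(\mu)$ for the downset of matching $\mu$. The basis $\Phi_{\mathsf{rot}}$ has one commitment $\varphi_\rho$ per rotation, acting on an admissible set $S$ by $\varphi_\rho(S)=\{\mu\in S:\rho\in\mathsf{ds}(\mu)\}$ if $\rho$ is exposed in $S$ (all predecessors of $\rho$ in $\Pi$ lie in $\mathsf{ds}(\mu)$ for every $\mu\in S$), and $\varphi_\rho(S)=S$ otherwise. Determination depth $\mathsf{Depth}_\Phi(\mathsf{Spec})$: the minimum, over sequences of commitments from $\Phi$ that shrink the admissible set to a singleton while keeping it nonempty, of the minimum number of consecutive layers into which the sequence can be partitioned so that within each layer the commitments give the same admissible set when applied in any order (starting from the set produced by the earlier layers). -}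

module Defs where

open import Level using (0ℓ)
open import Data.Nat as ℕ using (ℕ; suc; _%_)
open import Data.Nat.DivMod using (m%n<n)
open import Data.Fin using (Fin; toℕ; fromℕ<; _<_; _≤_)
open import Data.Product using (Σ; ∃; _×_; _,_)
open import Data.Unit using (⊤)
open import Data.List using (List; []; _∷_; concat; length)
open import Data.List.Relation.Unary.Linked using (Linked)
open import Data.List.Relation.Binary.Permutation.Propositional using (_↭_)
open import Function.Definitions using (Injective)
open import Relation.Nullary using (¬_)
open import Relation.Binary.PropositionalEquality using (_≡_; _≗_)

-- A stable matching instance: two sides A = Fin n and B = Fin n.
-- rankA a b = position of b on a's (complete, strict) preference list
-- (smaller = more preferred); likewise rankB.  Injectivity in the second
-- argument makes each list a strict total order on the whole other side.
record SMInstance : Set where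
  field
    n      : ℕ
    rankA  : Fin n → Fin n → Fin n
    rankB  : Fin n → Fin n → Fin n
    rankA-inj : ∀ a → Injective _≡_ _≡_ (rankA a)
    rankB-inj : ∀ b → Injective _≡_ _≡_ (rankB b)

csuc : ∀ {k} → Fin (suc k) → Fin (suc k)
csuc {k} i = fromℕ< (m%n<n (suc (toℕ i)) (suc k))

module _ (I : SMInstance) where
  open SMInstance I

  -- a (perfect) matching: a ↦ partner of a, a bijection A → B
  Matching : Set
  Matching = Fin n → Fin n

  Stable : Matching → Set
  Stable μ = ∀ a a' → ¬ (rankA a (μ a') < rankA a (μ a) × rankB (μ a') a < rankB (μ a') a')

  IsStableMatching : Matching → Set
  IsStableMatching μ = Injective _≡_ _≡_ μ × Stable μ

  StablePair : Fin n → Fin n → Set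
  StablePair a b = ∃ λ μ → IsStableMatching μ × μ a ≡ b

  NextStable : Fin n → Fin n → Fin n → Set
  NextStable a b b' =
    rankA a b < rankA a b' × StablePair a b'
    × (∀ c → StablePair a c → rankA a b < rankA a c → rankA a b' ≤ rankA a c)

  record Rotation : Set where
    field
      k        : ℕ
      as       : Fin (suc k) → Fin n
      bs       : Fin (suc k) → Fin n
      distinct : Injective _≡_ _≡_ as
      matched  : ∃ λ μ → IsStableMatching μ × (∀ i → μ (as i) ≡ bs i)
      next     : ∀ i → NextStable (as i) (bs i) (bs (csuc i))

  -- ρ ∈ ds(μ): ρ has been eliminated on the way to μ, i.e. each a_i is
  -- matched in μ strictly below b_i
  InDs : Rotation → Matching → Set
  InDs ρ μ = ∀ i → rankA (as i) (bs i) < rankA (as i) (μ (as i))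
    where open Rotation ρ

  _≼_ : Rotation → Rotation → Set
  ρ ≼ ρ' = ∀ μ → IsStableMatching μ → InDs ρ' μ → InDs ρ μ

  _≺_ : Rotation → Rotation → Set
  ρ ≺ ρ' = ρ ≼ ρ' × ¬ (ρ' ≼ ρ)

  IsChain : List Rotation → Set
  IsChain = Linked _≺_

  IsHeight : ℕ → Set
  IsHeight h = (Σ (List Rotation) λ c → IsChain c × length c ≡ h)
             × (∀ c → IsChain c → length c ℕ.≤ h)

  ASet : Set₁
  ASet = Matching → Set

  _≐_ : ASet → ASet → Set
  S ≐ T = ∀ μ → (S μ → T μ) × (T μ → S μ)

  SpecSM : ASet
  SpecSM = IsStableMatching

  Exposed : Rotation → ASet → Set
  Exposed ρ S = ∀ ρ' → ρ' ≺ ρ → ∀ μ → S μ → InDs ρ' μ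

  -- commitment φ_ρ: filters S to {μ : ρ ∈ ds μ} if ρ is exposed in S, else S
  -- (constructive rendering of the case split)
  φ : Rotation → ASet → ASet
  φ ρ S μ = S μ × (Exposed ρ S → InDs ρ μ)

  applySeq : List Rotation → ASet → ASet
  applySeq []       S = S
  applySeq (ρ ∷ ρs) S = applySeq ρs (φ ρ S)

  Nonempty : ASet → Set
  Nonempty S = ∃ λ μ → S μ

  Singleton : ASet → Set
  Singleton S = ∃ λ μ → S μ × (∀ ν → S ν → ν ≗ μ)

  AllNonempty : ASet → List Rotation → Set
  AllNonempty S []       = Nonempty S
  AllNonempty S (ρ ∷ ρs) = Nonempty S × AllNonempty (φ ρ S) ρs

  LayersOK : ASet → List (List Rotation) → Set
  LayersOK S []       = ⊤
  LayersOK S (L ∷ Ls) =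
    (∀ L' → L' ↭ L → applySeq L' S ≐ applySeq L S) × LayersOK (applySeq L S) Ls

  -- a determining sequence (concat Ls) partitioned into consecutive layers Ls
  ValidLayering : List (List Rotation) → Set
  ValidLayering Ls = AllNonempty SpecSM (concat Ls)
                   × Singleton (applySeq (concat Ls) SpecSM)
                   × LayersOK SpecSM Ls

  IsDepth : ℕ → Set
  IsDepth d = (Σ (List (List Rotation)) λ Ls → ValidLayering Ls × length Ls ≡ d)
            × (∀ Ls → ValidLayering Ls → d ℕ.≤ length Ls)

-- Fix a chain ρ₁ ≺ ⋯ ≺ ρₕ and a valid layering.  The admissible set stays up-closed and,
-- before the i-th layer, contains a stable matching ν with ρᵢ ∉ ds(ν).  The rotations of that layer
-- succeeding ρᵢ are never exposed while ν survives; each other one lies in ds of a stable matching avoiding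
-- ρᵢ₊₁, and the join of these with ν contains them all but still avoids ρᵢ₊₁.  Since the commitments of a
-- layer commute we may apply them in this order, so a matching avoiding ρᵢ₊₁ survives.  A singleton cannot
-- hold both a matching avoiding ρ and one containing it, so every chain element costs a layer.
--
-- Starting from the man-optimal stable matching, repeatedly eliminate at once all rotations
-- exposed in the current κ.  They are the cycles of a ↦ κ⁻¹(s_κ(a)), where s_κ(a) is the first woman after
-- κ(a) on a's list who prefers a to her partner, and the layer turns {μ : κ ⊑ μ} into {μ : κ' ⊑ μ} for κ'
-- the join of their eliminations.  Each rotation exposed in κ' has a predecessor in the layer at κ, so the
-- greedy layering carries a chain with one rotation per layer.

module Submission where

open import Defs hiding (_≼_; _≺_; _≐_)
import Defs
open import Data.Nat as ℕ using (ℕ; zero; suc; _+_; _*_; _∸_; z≤n; s≤s)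
open import Data.Nat.DivMod using (m≤n⇒m%n≡m; n%n≡0)
open import Data.Nat.GeneralisedArithmetic using (fold; fold-+)
import Data.Nat.Properties as ℕP
open import Data.Fin as F using (Fin; toℕ; fromℕ; fromℕ<; inject₁)
open import Data.Fin.Properties as FP using (toℕ-injective; pigeonhole; any?; all?)
open import Data.Fin.Induction using (<-weakInduction; <-weakInduction-startingFrom)
open import Data.Product using (Σ; ∃; ∃₂; _×_; _,_; proj₁; proj₂)
import Data.Product as Prod
open import Data.Sum using (_⊎_; inj₁; inj₂)
import Data.Sum as Sum
open import Data.Empty using (⊥; ⊥-elim)
open import Function.Definitions using (Injective)
open import Relation.Binary.PropositionalEquality
open import Relation.Binary.Definitions using (Tri; tri<; tri≈; tri>)
open import Relation.Nullary using (¬_; Dec; yes; no)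
open import Relation.Nullary.Decidable using (_×-dec_; _→-dec_; ¬?; map′; decidable-stable)
open import Relation.Unary using (Pred)
open import Function.Base using (_∘_; id)
import Data.Vec.Functional as V
import Data.Vec.Functional.Properties as VP
open import Data.Nat.Induction using (<-wellFounded)
open import Induction.WellFounded using (Acc; acc)
open import Data.List using (List; []; _∷_; _++_; concat; concatMap; length; foldr; map; allFin)
open import Data.List.Membership.Propositional using (_∈_)
open import Data.List.Membership.Propositional.Properties using (∈-map⁺; ∈-map⁻; ∈-allFin; ∈-concatMap⁺)
import Data.List.Relation.Unary.Any as Any
import Data.List.Relation.Unary.All.Properties as All
open import Data.List.Relation.Unary.Any using (here; there)
open import Data.List.Relation.Unary.All as All using (All; []; _∷_)
open import Data.List.Relation.Binary.Permutation.Propositional using (_↭_; prep; ↭-refl; ↭-trans; ↭-sym)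
open import Data.List.Relation.Binary.Permutation.Propositional.Properties using (shift; All-resp-↭)
open import Data.List.Relation.Unary.Linked using ([]; [-]; _∷_)

module _ {n : ℕ} (f : Fin n → Fin n) where

  fold-closed : ∀ {ℓ} (P : Pred (Fin n) ℓ) → (∀ {a} → P a → P (f a)) →
                ∀ k {a} → P a → P (fold a f k)
  fold-closed P step zero    p = p
  fold-closed P step (suc k) p = step (fold-closed P step k p)

  eventually-periodic : ∀ x → ∃₂ λ i (d : Fin n) → fold (fold x f i) f (suc (toℕ d)) ≡ fold x f i
  eventually-periodic x
    with i , j , i<j , eq ← pigeonhole (ℕP.n<1+n n) (λ (j : Fin (suc n)) → fold x f (toℕ j))
    = toℕ i , fromℕ< d<n , cycle
    where
    open ≡-Reasoning
    d = toℕ j ∸ suc (toℕ i)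
    d+i≡j : suc d + toℕ i ≡ toℕ j
    d+i≡j = trans (ℕP.+-comm (suc d) (toℕ i)) (trans (ℕP.+-suc (toℕ i) d) (ℕP.m+[n∸m]≡n i<j))
    d<n : d ℕ.< n
    d<n = ℕP.≤-trans (ℕP.m≤m+n (suc d) (toℕ i))
                     (subst (ℕ._≤ n) (sym d+i≡j) (ℕP.≤-pred (FP.toℕ<n j)))
    cycle : fold (fold x f (toℕ i)) f (suc (toℕ (fromℕ< d<n))) ≡ fold x f (toℕ i)
    cycle = begin
      fold (fold x f (toℕ i)) f (suc (toℕ (fromℕ< d<n)))
        ≡⟨ cong (λ t → fold (fold x f (toℕ i)) f (suc t)) (FP.toℕ-fromℕ< d<n) ⟩
      fold (fold x f (toℕ i)) f (suc d) ≡⟨ fold-+ x f (suc d) ⟨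
      fold x f (suc d + toℕ i)          ≡⟨ cong (fold x f) d+i≡j ⟩
      fold x f (toℕ j)                  ≡⟨ eq ⟨
      fold x f (toℕ i)                  ∎

  fold-injective-within-period : ∀ {a k} → (∀ q → q ℕ.< k → fold a f (suc q) ≢ a) →
                                 fold a f (suc k) ≡ a →
                                 ∀ {x y} → x ℕ.< y → y ℕ.≤ k → fold a f x ≢ fold a f y
  fold-injective-within-period {a} {k} minimal period {x} {y} x<y y≤k eq = minimal q q<k shorter
    where
    open ≡-Reasoning
    q = (k ∸ y) + x
    k∸y+y≡k : (k ∸ y) + y ≡ k
    k∸y+y≡k = ℕP.m∸n+n≡m y≤k
    q<k : q ℕ.< k
    q<k = subst (q ℕ.<_) k∸y+y≡k (ℕP.+-monoʳ-< (k ∸ y) x<y)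
    shorter : fold a f (suc q) ≡ a
    shorter = begin
      fold a f (suc (k ∸ y) + x)        ≡⟨ fold-+ a f (suc (k ∸ y)) ⟩
      fold (fold a f x) f (suc (k ∸ y)) ≡⟨ cong (λ z → fold z f (suc (k ∸ y))) eq ⟩
      fold (fold a f y) f (suc (k ∸ y)) ≡⟨ fold-+ a f (suc (k ∸ y)) ⟨
      fold a f (suc ((k ∸ y) + y))      ≡⟨ cong (λ t → fold a f (suc t)) k∸y+y≡k ⟩
      fold a f (suc k)                  ≡⟨ period ⟩
      a                                 ∎

  module _ (f-inj : Injective _≡_ _≡_ f) where

    fold-cancel : ∀ k {x y} → fold x f k ≡ fold y f k → x ≡ y
    fold-cancel zero    eq = eq
    fold-cancel (suc k) eq = fold-cancel k (f-inj eq)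

    periodic : ∀ x → ∃ λ d → fold x f (suc d) ≡ x
    periodic x with i , d′ , cycle ← eventually-periodic x = d , fold-cancel i shifted
      where
      open ≡-Reasoning
      d = toℕ d′
      shifted : fold (fold x f (suc d)) f i ≡ fold x f i
      shifted = begin
        fold (fold x f (suc d)) f i ≡⟨ fold-+ x f i ⟨
        fold x f (i + suc d)        ≡⟨ cong (fold x f) (ℕP.+-comm i (suc d)) ⟩
        fold x f (suc d + i)        ≡⟨ fold-+ x f (suc d) ⟩
        fold (fold x f i) f (suc d) ≡⟨ cycle ⟩
        fold x f i                  ∎

    opaque
      inverse : Fin n → Fin n
      inverse b = fold b f (proj₁ (periodic b))

      inverseʳ : ∀ b → f (inverse b) ≡ b
      inverseʳ b = proj₂ (periodic b)

      inverseˡ : ∀ a → inverse (f a) ≡ a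
      inverseˡ a = f-inj (inverseʳ (f a))

      inverse-closed : ∀ {ℓ} (P : Pred (Fin n) ℓ) → (∀ {a} → P a → P (f a)) →
                       ∀ {a} → P a → P (inverse a)
      inverse-closed P step {a} = fold-closed P step (proj₁ (periodic a))

last-or-inject₁ : ∀ {k} (i : Fin (suc k)) → i ≡ fromℕ k ⊎ ∃ λ j → i ≡ inject₁ j
last-or-inject₁ {zero}  F.zero    = inj₁ refl
last-or-inject₁ {suc k} F.zero    = inj₂ (F.zero , refl)
last-or-inject₁ {suc k} (F.suc i) with last-or-inject₁ i
... | inj₁ refl       = inj₁ refl
... | inj₂ (j , refl) = inj₂ (F.suc j , refl)

csuc-inject₁ : ∀ {k} (i : Fin k) → csuc (inject₁ i) ≡ F.suc i
csuc-inject₁ {k} i = toℕ-injective (begin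
  toℕ (csuc (inject₁ i))       ≡⟨ FP.toℕ-fromℕ< _ ⟩
  suc (toℕ (inject₁ i)) ℕ.% suc k ≡⟨ cong (λ t → suc t ℕ.% suc k) (FP.toℕ-inject₁ i) ⟩
  suc (toℕ i) ℕ.% suc k        ≡⟨ m≤n⇒m%n≡m (FP.toℕ<n i) ⟩
  suc (toℕ i)                  ∎)
  where open ≡-Reasoning

csuc-fromℕ : ∀ k → csuc (fromℕ k) ≡ F.zero
csuc-fromℕ k = toℕ-injective (begin
  toℕ (csuc (fromℕ k))         ≡⟨ FP.toℕ-fromℕ< _ ⟩
  suc (toℕ (fromℕ k)) ℕ.% suc k ≡⟨ cong (λ t → suc t ℕ.% suc k) (FP.toℕ-fromℕ k) ⟩
  suc k ℕ.% suc k              ≡⟨ n%n≡0 (suc k) ⟩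
  0                            ∎)
  where open ≡-Reasoning

csuc-injective : ∀ {k} → Injective _≡_ _≡_ (csuc {k})
csuc-injective {k} {i} {j} eq with last-or-inject₁ i | last-or-inject₁ j
... | inj₁ refl       | inj₁ refl       = refl
... | inj₂ (a , refl) | inj₂ (b , refl) =
  cong inject₁ (FP.suc-injective (trans (sym (csuc-inject₁ a)) (trans eq (csuc-inject₁ b))))
... | inj₁ refl       | inj₂ (b , refl) with () ← trans (sym (csuc-fromℕ k)) (trans eq (csuc-inject₁ b))
... | inj₂ (a , refl) | inj₁ refl       with () ← trans (sym (csuc-inject₁ a)) (trans eq (csuc-fromℕ k))

cyclic-induction : ∀ {k ℓ} (P : Pred (Fin (suc k)) ℓ) → (∀ i → P i → P (csuc i)) →
                   ∀ {i} → P i → ∀ j → P j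
cyclic-induction {k} P step {i} Pi = <-weakInduction P P₀ step′
  where
  step′ : ∀ j → P (inject₁ j) → P (F.suc j)
  step′ j = subst P (csuc-inject₁ j) ∘ step (inject₁ j)
  P₀ : P F.zero
  P₀ = subst P (csuc-fromℕ k) (step _ (<-weakInduction-startingFrom P Pi step′ (FP.≤fromℕ i)))

argmin? : ∀ {m ℓ} (key : Fin m → ℕ) {P : Pred (Fin m) ℓ} → (∀ b → Dec (P b)) →
          (∃ λ b → P b × ∀ c → P c → key b ℕ.≤ key c) ⊎ (∀ c → ¬ P c)
argmin? {zero}  key P? = inj₂ (λ ())
argmin? {suc m} key P? with argmin? (key ∘ F.suc) (P? ∘ F.suc) | P? F.zero
... | inj₂ none           | no ¬p₀ = inj₂ λ { F.zero → ¬p₀ ; (F.suc i) → none i }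
... | inj₂ none           | yes p₀ =
  inj₁ (F.zero , p₀ , λ { F.zero _ → ℕP.≤-refl ; (F.suc i) q → ⊥-elim (none i q) })
... | inj₁ (b , pb , min) | no ¬p₀ =
  inj₁ (F.suc b , pb , λ { F.zero q → ⊥-elim (¬p₀ q) ; (F.suc i) q → min i q })
... | inj₁ (b , pb , min) | yes p₀ with key F.zero ℕ.≤? key (F.suc b)
...   | yes ≤b =
  inj₁ (F.zero , p₀ , λ { F.zero _ → ℕP.≤-refl ; (F.suc i) q → ℕP.≤-trans ≤b (min i q) })
...   | no  ≰b =
  inj₁ (F.suc b , pb , λ { F.zero _ → ℕP.<⇒≤ (ℕP.≰⇒> ≰b) ; (F.suc i) q → min i q })

∷-cong : ∀ {m} {A : Set} {x : A} {g h : Fin m → A} → g ≗ h → (x V.∷ g) ≗ (x V.∷ h)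
∷-cong g≗h F.zero    = refl
∷-cong g≗h (F.suc i) = g≗h i

any-function? : ∀ {m n ℓ} (P : Pred (Fin m → Fin n) ℓ) → (∀ {f g} → f ≗ g → P f → P g) →
                (∀ f → Dec (P f)) → Dec (∃ P)
any-function? {zero} P resp P? with P? (λ ())
... | yes p = yes (_ , p)
... | no ¬p = no λ { (f , p) → ¬p (resp (λ ()) p) }
any-function? {suc m} P resp P?
  with any? (λ x → any-function? (P ∘ (x V.∷_)) (resp ∘ ∷-cong) (P? ∘ (x V.∷_)))
... | yes (x , g , p) = yes (_ , p)
... | no ¬p = no λ { (f , p) →
  ¬p (V.head f , V.tail f , resp (λ { F.zero → refl ; (F.suc i) → refl }) p) }

module _ {k} {A : Set} (f : A → A) (g : Fin (suc k) → A) (g-step : ∀ i → f (g i) ≡ g (csuc i)) where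

  fold-along : ∀ i → fold (g F.zero) f (toℕ i) ≡ g i
  fold-along = <-weakInduction (λ i → fold (g F.zero) f (toℕ i) ≡ g i) refl step
    where
    step : ∀ j → fold (g F.zero) f (toℕ (inject₁ j)) ≡ g (inject₁ j) →
           fold (g F.zero) f (suc (toℕ j)) ≡ g (F.suc j)
    step j eq = trans (cong (λ t → f (fold (g F.zero) f t)) (sym (FP.toℕ-inject₁ j)))
                      (trans (cong f eq) (trans (g-step (inject₁ j)) (cong g (csuc-inject₁ j))))

  fold-around : fold (g F.zero) f (suc k) ≡ g F.zero
  fold-around = trans (cong (λ t → f (fold (g F.zero) f t)) (sym (FP.toℕ-fromℕ k)))
                (trans (cong f (fold-along (fromℕ k)))
                (trans (g-step (fromℕ k)) (cong g (csuc-fromℕ k))))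

injective? : ∀ {m n} (f : Fin m → Fin n) → Dec (Injective _≡_ _≡_ f)
injective? f = map′ (λ inj {x} {y} → inj x y) (λ inj x y → inj)
                    (all? λ x → all? λ y → (f x FP.≟ f y) →-dec (x FP.≟ y))

sumᶠ : ∀ {m} → (Fin m → ℕ) → ℕ
sumᶠ {zero}  f = 0
sumᶠ {suc m} f = f F.zero + sumᶠ (f ∘ F.suc)

sumᶠ-mono-≤ : ∀ {m} {f g : Fin m → ℕ} → (∀ i → f i ℕ.≤ g i) → sumᶠ f ℕ.≤ sumᶠ g
sumᶠ-mono-≤ {zero}  f≤g = z≤n
sumᶠ-mono-≤ {suc m} f≤g = ℕP.+-mono-≤ (f≤g F.zero) (sumᶠ-mono-≤ (f≤g ∘ F.suc))

sumᶠ-mono-< : ∀ {m} {f g : Fin m → ℕ} → (∀ i → f i ℕ.≤ g i) → ∀ j → f j ℕ.< g j →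
              sumᶠ f ℕ.< sumᶠ g
sumᶠ-mono-< {suc m} f≤g F.zero    f<g = ℕP.+-mono-<-≤ f<g (sumᶠ-mono-≤ (f≤g ∘ F.suc))
sumᶠ-mono-< {suc m} f≤g (F.suc j) f<g = ℕP.+-mono-≤-< (f≤g F.zero) (sumᶠ-mono-< (f≤g ∘ F.suc) j f<g)

sumᶠ-≤-* : ∀ {m} {f : Fin m → ℕ} {B} → (∀ i → f i ℕ.≤ B) → sumᶠ f ℕ.≤ m * B
sumᶠ-≤-* {zero}  f≤B = z≤n
sumᶠ-≤-* {suc m} f≤B = ℕP.+-mono-≤ (f≤B F.zero) (sumᶠ-≤-* (f≤B ∘ F.suc))

module _ (I : SMInstance) where
  open SMInstance I

  SM : Matching I → Set
  SM = IsStableMatching I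

  _≼_ : Rotation I → Rotation I → Set
  _≼_ = Defs._≼_ I

  _≺_ : Rotation I → Rotation I → Set
  _≺_ = Defs._≺_ I

  _≐_ : ASet I → ASet I → Set
  _≐_ = Defs._≐_ I

  rA : Fin n → Fin n → ℕ
  rA a b = toℕ (rankA a b)

  rB : Fin n → Fin n → ℕ
  rB b a = toℕ (rankB b a)

  rA-injective : ∀ a {b c} → rA a b ≡ rA a c → b ≡ c
  rA-injective a = rankA-inj a ∘ toℕ-injective

  rB-injective : ∀ b {a c} → rB b a ≡ rB b c → a ≡ c
  rB-injective b = rankB-inj b ∘ toℕ-injective

  rA-≤∧≢⇒< : ∀ a {b c} → b ≢ c → rA a b ℕ.≤ rA a c → rA a b ℕ.< rA a c
  rA-≤∧≢⇒< a b≢c b≤c = ℕP.≤∧≢⇒< b≤c (b≢c ∘ rA-injective a)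

  rB-≤∧≢⇒< : ∀ b {a c} → a ≢ c → rB b a ℕ.≤ rB b c → rB b a ℕ.< rB b c
  rB-≤∧≢⇒< b a≢c a≤c = ℕP.≤∧≢⇒< a≤c (a≢c ∘ rB-injective b)

  Blocks : Matching I → Fin n → Fin n → Set
  Blocks μ x y = rA x (μ y) ℕ.< rA x (μ x) × rB (μ y) x ℕ.< rB (μ y) y

  stable⇒rival-rejected : ∀ {μ} → SM μ → ∀ x y → rA x (μ y) ℕ.< rA x (μ x) → x ≢ y →
                          rB (μ y) y ℕ.< rB (μ y) x
  stable⇒rival-rejected (_ , stable) x y x-covets x≢y =
    rB-≤∧≢⇒< _ (x≢y ∘ sym) (ℕP.≮⇒≥ (λ x-preferred → stable x y (x-covets , x-preferred)))

  _⊑_ : Matching I → Matching I → Set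
  μ ⊑ ν = ∀ a → rA a (μ a) ℕ.≤ rA a (ν a)

  ⊑-refl : ∀ {μ} → μ ⊑ μ
  ⊑-refl a = ℕP.≤-refl

  ⊑-trans : ∀ {μ ν ξ} → μ ⊑ ν → ν ⊑ ξ → μ ⊑ ξ
  ⊑-trans μ⊑ν ν⊑ξ a = ℕP.≤-trans (μ⊑ν a) (ν⊑ξ a)

  Prefers : Matching I → Matching I → Fin n → Set
  Prefers μ ν a = rA a (μ a) ℕ.< rA a (ν a)

  opaque
    _⊓_ : Matching I → Matching I → Matching I
    (μ ⊓ ν) a with rA a (μ a) ℕ.<? rA a (ν a)
    ... | yes _ = μ a
    ... | no  _ = ν a

    _⊔_ : Matching I → Matching I → Matching I
    (μ ⊔ ν) a with rA a (μ a) ℕ.<? rA a (ν a)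
    ... | yes _ = ν a
    ... | no  _ = μ a

    ⊓-view : ∀ μ ν a → (Prefers μ ν a × (μ ⊓ ν) a ≡ μ a) ⊎
                       (¬ Prefers μ ν a × (μ ⊓ ν) a ≡ ν a)
    ⊓-view μ ν a with rA a (μ a) ℕ.<? rA a (ν a)
    ... | yes p = inj₁ (p , refl)
    ... | no ¬p = inj₂ (¬p , refl)

    ⊔-view : ∀ μ ν a → (Prefers μ ν a × (μ ⊔ ν) a ≡ ν a) ⊎
                       (¬ Prefers μ ν a × (μ ⊔ ν) a ≡ μ a)
    ⊔-view μ ν a with rA a (μ a) ℕ.<? rA a (ν a)
    ... | yes p = inj₁ (p , refl)
    ... | no ¬p = inj₂ (¬p , refl)

  ⊓-sel : ∀ μ ν a → (μ ⊓ ν) a ≡ μ a ⊎ (μ ⊓ ν) a ≡ ν a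
  ⊓-sel μ ν a = Sum.map proj₂ proj₂ (⊓-view μ ν a)

  ⊔-sel : ∀ μ ν a → (μ ⊔ ν) a ≡ μ a ⊎ (μ ⊔ ν) a ≡ ν a
  ⊔-sel μ ν a = Sum.swap (Sum.map proj₂ proj₂ (⊔-view μ ν a))

  ⊓-lowerˡ : ∀ μ ν → (μ ⊓ ν) ⊑ μ
  ⊓-lowerˡ μ ν a with ⊓-view μ ν a
  ... | inj₁ (_  , eq) rewrite eq = ℕP.≤-refl
  ... | inj₂ (¬p , eq) rewrite eq = ℕP.≮⇒≥ ¬p

  ⊓-lowerʳ : ∀ μ ν → (μ ⊓ ν) ⊑ ν
  ⊓-lowerʳ μ ν a with ⊓-view μ ν a
  ... | inj₁ (p , eq) rewrite eq = ℕP.<⇒≤ p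
  ... | inj₂ (_ , eq) rewrite eq = ℕP.≤-refl

  ⊔-upperˡ : ∀ μ ν → μ ⊑ (μ ⊔ ν)
  ⊔-upperˡ μ ν a with ⊔-view μ ν a
  ... | inj₁ (p , eq) rewrite eq = ℕP.<⇒≤ p
  ... | inj₂ (_ , eq) rewrite eq = ℕP.≤-refl

  ⊔-upperʳ : ∀ μ ν → ν ⊑ (μ ⊔ ν)
  ⊔-upperʳ μ ν a with ⊔-view μ ν a
  ... | inj₁ (_  , eq) rewrite eq = ℕP.≤-refl
  ... | inj₂ (¬p , eq) rewrite eq = ℕP.≮⇒≥ ¬p

  ⊔-least : ∀ {μ ν ξ} → μ ⊑ ξ → ν ⊑ ξ → (μ ⊔ ν) ⊑ ξ
  ⊔-least {μ} {ν} μ⊑ξ ν⊑ξ a with ⊔-sel μ ν a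
  ... | inj₁ eq rewrite eq = μ⊑ξ a
  ... | inj₂ eq rewrite eq = ν⊑ξ a

  ⊔-≡ˡ : ∀ μ ν a → rA a (ν a) ℕ.≤ rA a (μ a) → (μ ⊔ ν) a ≡ μ a
  ⊔-≡ˡ μ ν a ν≤μ with ⊔-view μ ν a
  ... | inj₁ (p , _) = ⊥-elim (ℕP.<⇒≱ p ν≤μ)
  ... | inj₂ (_ , eq) = eq

  ⊔-≡ʳ : ∀ μ ν a → rA a (μ a) ℕ.≤ rA a (ν a) → (μ ⊔ ν) a ≡ ν a
  ⊔-≡ʳ μ ν a μ≤ν with ⊔-view μ ν a
  ... | inj₁ (_ , eq) = eq
  ... | inj₂ (¬p , eq) = trans eq (rA-injective a (ℕP.≤-antisym μ≤ν (ℕP.≮⇒≥ ¬p)))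

  blocks-⊒ : ∀ {ξ σ} → ξ ⊑ σ → ∀ {x y} → ξ y ≡ σ y → Blocks ξ x y → Blocks σ x y
  blocks-⊒ {ξ} {σ} ξ⊑σ {x} {y} eq (x-covets , x-preferred) =
    subst (λ w → rA x w ℕ.< rA x (σ x)) eq (ℕP.<-≤-trans x-covets (ξ⊑σ x)) ,
    subst (λ w → rB w x ℕ.< rB w y) eq x-preferred

  blocks-⊑ : ∀ {ξ σ x y y'} → ξ x ≡ σ x → σ y' ≡ ξ y → rB (ξ y) y ℕ.≤ rB (ξ y) y' →
             Blocks ξ x y → Blocks σ x y'
  blocks-⊑ {ξ} {σ} {x} {y} {y'} ξx≡σx σy'≡ξy y≤y' (x-covets , x-preferred) =
    subst₂ (λ w v → rA x w ℕ.< rA x v) (sym σy'≡ξy) ξx≡σx x-covets ,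
    subst (λ w → rB w x ℕ.< rB w y') (sym σy'≡ξy) (ℕP.<-≤-trans x-preferred y≤y')

  -- With A the men who prefer μ to ν, stability of μ and ν makes μ map A into ν(A); as ν⁻¹ ∘ μ is
  -- injective on a finite set, it then maps A onto A.
  module _ {μ ν} (sμ : SM μ) (sν : SM ν) where

    μ[A]⊆ν[A] : ∀ {a y} → Prefers μ ν a → ν y ≡ μ a → Prefers μ ν y
    μ[A]⊆ν[A] {a} {y} a-prefers νy≡μa with rA y (μ y) ℕ.<? rA y (ν y)
    ... | yes y-prefers = y-prefers
    ... | no ¬y-prefers = ⊥-elim (proj₂ sμ y a (y-covets , y-preferred))
      where
      y≢a : y ≢ a
      y≢a refl = ℕP.<-irrefl (cong (rA a) (sym νy≡μa)) a-prefers
      y-preferred : rB (μ a) y ℕ.< rB (μ a) a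
      y-preferred = subst (λ w → rB w y ℕ.< rB w a) νy≡μa
        (stable⇒rival-rejected sν a y (subst (λ w → rA a w ℕ.< rA a (ν a)) (sym νy≡μa) a-prefers)
                                       (y≢a ∘ sym))
      y-covets : rA y (μ a) ℕ.< rA y (μ y)
      y-covets = subst (λ w → rA y w ℕ.< rA y (μ y)) νy≡μa
        (rA-≤∧≢⇒< y (λ νy≡μy → y≢a (proj₁ sμ (trans (sym νy≡μy) νy≡μa)))
                    (ℕP.≮⇒≥ ¬y-prefers))

    ν[A]⊆μ[A] : ∀ {x y} → Prefers μ ν x → ν x ≡ μ y → Prefers μ ν y
    ν[A]⊆μ[A] {x} {y} x-prefers νx≡μy =
      subst (Prefers μ ν) (proj₁ sμ μx'≡μy)
            (inverse-closed h h-injective (Prefers μ ν) h-closed x-prefers)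
      where
      ν⁻¹ = inverse ν (proj₁ sν)
      νν⁻¹ = inverseʳ ν (proj₁ sν)
      h : Fin n → Fin n
      h = ν⁻¹ ∘ μ
      h-injective : Injective _≡_ _≡_ h
      h-injective {a} {b} eq = proj₁ sμ (trans (sym (νν⁻¹ (μ a))) (trans (cong ν eq) (νν⁻¹ (μ b))))
      h-closed : ∀ {a} → Prefers μ ν a → Prefers μ ν (h a)
      h-closed p = μ[A]⊆ν[A] p (νν⁻¹ _)
      x' = inverse h h-injective x
      μx'≡μy : μ x' ≡ μ y
      μx'≡μy = trans (sym (νν⁻¹ (μ x'))) (trans (cong ν (inverseʳ h h-injective x)) νx≡μy)

  ⊓-injective : ∀ {μ ν} → SM μ → SM ν → Injective _≡_ _≡_ (μ ⊓ ν)
  ⊓-injective {μ} {ν} sμ sν {x} {y} eq with ⊓-view μ ν x | ⊓-view μ ν y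
  ... | inj₁ (_ , ex) | inj₁ (_ , ey) = proj₁ sμ (trans (sym ex) (trans eq ey))
  ... | inj₂ (_ , ex) | inj₂ (_ , ey) = proj₁ sν (trans (sym ex) (trans eq ey))
  ... | inj₁ (px , ex) | inj₂ (¬py , ey) =
    ⊥-elim (¬py (μ[A]⊆ν[A] sμ sν px (trans (sym ey) (trans (sym eq) ex))))
  ... | inj₂ (¬px , ex) | inj₁ (py , ey) =
    ⊥-elim (¬px (μ[A]⊆ν[A] sμ sν py (trans (sym ex) (trans eq ey))))

  ⊔-injective : ∀ {μ ν} → SM μ → SM ν → Injective _≡_ _≡_ (μ ⊔ ν)
  ⊔-injective {μ} {ν} sμ sν {x} {y} eq with ⊔-view μ ν x | ⊔-view μ ν y
  ... | inj₁ (_ , ex) | inj₁ (_ , ey) = proj₁ sν (trans (sym ex) (trans eq ey))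
  ... | inj₂ (_ , ex) | inj₂ (_ , ey) = proj₁ sμ (trans (sym ex) (trans eq ey))
  ... | inj₁ (px , ex) | inj₂ (¬py , ey) =
    ⊥-elim (¬py (ν[A]⊆μ[A] sμ sν px (trans (sym ex) (trans eq ey))))
  ... | inj₂ (¬px , ex) | inj₁ (py , ey) =
    ⊥-elim (¬px (ν[A]⊆μ[A] sμ sν py (trans (sym ey) (trans (sym eq) ex))))

  ⊓-stable : ∀ {μ ν} → SM μ → SM ν → SM (μ ⊓ ν)
  ⊓-stable {μ} {ν} sμ sν = ⊓-injective sμ sν , stable
    where
    stable : Stable I (μ ⊓ ν)
    stable x y blocks with ⊓-sel μ ν y
    ... | inj₁ eq = proj₂ sμ x y (blocks-⊒ (⊓-lowerˡ μ ν) eq blocks)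
    ... | inj₂ eq = proj₂ sν x y (blocks-⊒ (⊓-lowerʳ μ ν) eq blocks)

  envelope-favours-women : ∀ {ξ σ τ} → Injective _≡_ _≡_ ξ → (∀ a → ξ a ≡ σ a ⊎ ξ a ≡ τ a) →
                           σ ⊑ ξ → Injective _≡_ _≡_ σ → SM τ →
                           ∀ {y y'} → σ y' ≡ ξ y → rB (ξ y) y ℕ.≤ rB (ξ y) y'
  envelope-favours-women {ξ} {σ} {τ} ξ-inj sel σ⊑ξ σ-inj sτ {y} {y'} σy'≡ξy with y' FP.≟ y
  ... | yes refl = ℕP.≤-refl
  ... | no y'≢y = ℕP.<⇒≤ (subst (λ w → rB w y ℕ.< rB w y') (sym ξy≡τy)
                           (stable⇒rival-rejected sτ y' y y'-covets y'≢y))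
    where
    ξy≡τy : ξ y ≡ τ y
    ξy≡τy = Sum.[ (λ ξy≡σy → ⊥-elim (y'≢y (σ-inj (trans σy'≡ξy ξy≡σy)))) , id ] (sel y)
    ξy'≡τy' : ξ y' ≡ τ y'
    ξy'≡τy' = Sum.[ (λ ξy'≡σy' → ⊥-elim (y'≢y (ξ-inj (trans ξy'≡σy' σy'≡ξy)))) , id ] (sel y')
    y'-covets : rA y' (τ y) ℕ.< rA y' (τ y')
    y'-covets = subst₂ (λ w v → rA y' w ℕ.< rA y' v) (trans σy'≡ξy ξy≡τy) ξy'≡τy'
      (rA-≤∧≢⇒< y' (λ σy'≡ξy' → y'≢y (sym (ξ-inj (trans (sym σy'≡ξy) σy'≡ξy')))) (σ⊑ξ y'))

  ⊔-stable : ∀ {μ ν} → SM μ → SM ν → SM (μ ⊔ ν)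
  ⊔-stable {μ} {ν} sμ sν = ⊔-inj , stable
    where
    ⊔-inj = ⊔-injective sμ sν
    unblocked-via : ∀ {σ τ} → SM σ → SM τ → σ ⊑ (μ ⊔ ν) →
                    (∀ a → (μ ⊔ ν) a ≡ σ a ⊎ (μ ⊔ ν) a ≡ τ a) →
                    ∀ x y → (μ ⊔ ν) x ≡ σ x → ¬ Blocks (μ ⊔ ν) x y
    unblocked-via {σ} sσ sτ σ⊑ sel x y eq blocks =
      proj₂ sσ x y' (blocks-⊑ eq σy'≡ (envelope-favours-women ⊔-inj sel σ⊑ (proj₁ sσ) sτ σy'≡)
                              blocks)
      where
      y' = inverse σ (proj₁ sσ) ((μ ⊔ ν) y)
      σy'≡ = inverseʳ σ (proj₁ sσ) ((μ ⊔ ν) y)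
    stable : Stable I (μ ⊔ ν)
    stable x y with ⊔-sel μ ν x
    ... | inj₁ eq = unblocked-via sμ sν (⊔-upperˡ μ ν) (⊔-sel μ ν) x y eq
    ... | inj₂ eq = unblocked-via sν sμ (⊔-upperʳ μ ν) (Sum.swap ∘ ⊔-sel μ ν) x y eq

  _∈ds_ : Rotation I → Matching I → Set
  ρ ∈ds μ = InDs I ρ μ

  ∈ds-resp-≗ : ∀ ρ {μ ν} → μ ≗ ν → ρ ∈ds μ → ρ ∈ds ν
  ∈ds-resp-≗ ρ μ≗ν ρ∈μ i = subst (λ w → rA (as i) (bs i) ℕ.< rA (as i) w) (μ≗ν (as i)) (ρ∈μ i)
    where open Rotation ρ

  ∈ds-mono : ∀ ρ {μ ν} → μ ⊑ ν → ρ ∈ds μ → ρ ∈ds ν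
  ∈ds-mono ρ μ⊑ν ρ∈μ i = ℕP.<-≤-trans (ρ∈μ i) (μ⊑ν (Rotation.as ρ i))

  _∈ds?_ : ∀ ρ μ → Dec (ρ ∈ds μ)
  ρ ∈ds? μ = all? (λ i → rA (as i) (bs i) ℕ.<? rA (as i) (μ (as i)))
    where open Rotation ρ

  module RotationFacts (ρ : Rotation I) where
    open Rotation ρ

    μρ : Matching I
    μρ = proj₁ matched

    μρ-stable : SM μρ
    μρ-stable = proj₁ (proj₂ matched)

    μρ-as : ∀ i → μρ (as i) ≡ bs i
    μρ-as = proj₂ (proj₂ matched)

    next-later : ∀ i → rA (as i) (bs i) ℕ.< rA (as i) (bs (csuc i))
    next-later i = proj₁ (next i)

    next-first : ∀ i c → StablePair I (as i) c → rA (as i) (bs i) ℕ.< rA (as i) c →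
                 rA (as i) (bs (csuc i)) ℕ.≤ rA (as i) c
    next-first i = proj₂ (proj₂ (next i))

    successor-prefers-predecessor : ∀ i → as i ≢ as (csuc i) →
                                    rB (bs (csuc i)) (as i) ℕ.< rB (bs (csuc i)) (as (csuc i))
    successor-prefers-predecessor i a≢a' with ν , sν , νa≡b' ← proj₁ (proj₂ (next i)) =
      subst (λ w → rB w a ℕ.< rB w a') ξa≡b' (stable⇒rival-rejected sξ a' a a'-covets (a≢a' ∘ sym))
      where
      a = as i
      a' = as (csuc i)
      b' = bs (csuc i)
      ξ = ν ⊔ μρ
      sξ = ⊔-stable sν μρ-stable
      ξa≡b' : ξ a ≡ b'
      ξa≡b' = trans (⊔-≡ˡ ν μρ a (subst₂ (λ w v → rA a w ℕ.≤ rA a v) (sym (μρ-as i)) (sym νa≡b')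
                                          (ℕP.<⇒≤ (next-later i))))
                    νa≡b'
      a'-covets : rA a' (ξ a) ℕ.< rA a' (ξ a')
      a'-covets = subst (λ w → rA a' w ℕ.< rA a' (ξ a')) (sym ξa≡b')
        (rA-≤∧≢⇒< a' (λ b'≡ξa' → a≢a' (proj₁ sξ (trans ξa≡b' b'≡ξa')))
          (subst (λ w → rA a' w ℕ.≤ rA a' (ξ a')) (μρ-as (csuc i)) (⊔-upperʳ ν μρ a')))

    Passed : Matching I → Fin (suc k) → Set
    Passed ν i = rA (as i) (bs i) ℕ.< rA (as i) (ν (as i))

    passed-step : ∀ {ν} → SM ν → ∀ i → Passed ν i → Passed ν (csuc i)
    passed-step {ν} sν i passed with as i FP.≟ as (csuc i)
    ... | yes a≡a' = subst (Passed ν) (distinct a≡a') passed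
    ... | no a≢a' with rA (as (csuc i)) (bs (csuc i)) ℕ.<? rA (as (csuc i)) (ν (as (csuc i)))
    ...   | yes passed' = passed'
    ...   | no ¬passed' = ⊥-elim (ℕP.<-asym (successor-prefers-predecessor i a≢a') b'-prefers-a')
      where
      a = as i
      a' = as (csuc i)
      b' = bs (csuc i)
      ξ = ν ⊔ μρ
      sξ = ⊔-stable sν μρ-stable
      ξa'≡b' : ξ a' ≡ b'
      ξa'≡b' = trans (⊔-≡ʳ ν μρ a' (subst (λ w → rA a' (ν a') ℕ.≤ rA a' w) (sym (μρ-as (csuc i)))
                                         (ℕP.≮⇒≥ ¬passed'))) (μρ-as (csuc i))
      ξa≡νa : ξ a ≡ ν a
      ξa≡νa = ⊔-≡ˡ ν μρ a
                (subst (λ w → rA a w ℕ.≤ rA a (ν a)) (sym (μρ-as i)) (ℕP.<⇒≤ passed))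
      a-covets : rA a (ξ a') ℕ.< rA a (ξ a)
      a-covets = subst₂ (λ w v → rA a w ℕ.< rA a v) (sym ξa'≡b') (sym ξa≡νa)
        (rA-≤∧≢⇒< a (λ b'≡νa → a≢a' (proj₁ sξ (trans ξa≡νa (trans (sym b'≡νa) (sym ξa'≡b')))))
          (next-first i (ν a) (ν , sν , refl) passed))
      b'-prefers-a' : rB b' a' ℕ.< rB b' a
      b'-prefers-a' = subst (λ w → rB w a' ℕ.< rB w a) ξa'≡b' (stable⇒rival-rejected sξ a a' a-covets a≢a')

    all-or-nothing : ∀ {ν} → SM ν → ∀ i → Passed ν i → ρ ∈ds ν
    all-or-nothing sν i = cyclic-induction _ (passed-step sν)

    ∉ds⇒not-passed : ∀ {ν} → SM ν → ¬ ρ ∈ds ν → ∀ i →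
                     rA (as i) (ν (as i)) ℕ.≤ rA (as i) (bs i)
    ∉ds⇒not-passed sν ρ∉ν i = ℕP.≮⇒≥ (ρ∉ν ∘ all-or-nothing sν i)

    ∉ds-μρ : ¬ ρ ∈ds μρ
    ∉ds-μρ ρ∈μρ = ℕP.<-irrefl (cong (rA (as F.zero)) (sym (μρ-as F.zero))) (ρ∈μρ F.zero)

    ∉ds-⊔ : ∀ {μ ν} → SM μ → SM ν → ¬ ρ ∈ds μ → ¬ ρ ∈ds ν → ¬ ρ ∈ds (μ ⊔ ν)
    ∉ds-⊔ {μ} {ν} sμ sν ρ∉μ ρ∉ν ρ∈⊔ =
      ℕP.<⇒≱ (ρ∈⊔ F.zero) (Sum.[ unpassed sμ ρ∉μ , unpassed sν ρ∉ν ]′ (⊔-sel μ ν a₀))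
      where
      a₀ = as F.zero
      unpassed : ∀ {σ} → SM σ → ¬ ρ ∈ds σ → (μ ⊔ ν) a₀ ≡ σ a₀ →
                 rA a₀ ((μ ⊔ ν) a₀) ℕ.≤ rA a₀ (bs F.zero)
      unpassed sσ ρ∉σ eq =
        subst (λ w → rA a₀ w ℕ.≤ rA a₀ (bs F.zero)) (sym eq) (∉ds⇒not-passed sσ ρ∉σ F.zero)

    ∈ds-witness : ∃ λ μ → SM μ × ρ ∈ds μ
    ∈ds-witness with μ , sμ , μa₀≡b₁ ← proj₁ (proj₂ (next F.zero)) =
      μ , sμ , all-or-nothing sμ F.zero (subst (Passed-by F.zero) (sym μa₀≡b₁) (next-later F.zero))
      where Passed-by = λ i w → rA (as i) (bs i) ℕ.< rA (as i) w

  SM-resp-≗ : ∀ {μ ν} → μ ≗ ν → SM μ → SM ν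
  SM-resp-≗ {μ} {ν} μ≗ν (inj , stable) =
    (λ {x} {y} eq → inj (trans (μ≗ν x) (trans eq (sym (μ≗ν y))))) ,
    (λ x y → stable x y ∘
      Prod.map (subst₂ (λ w v → rA x w ℕ.< rA x v) (sym (μ≗ν y)) (sym (μ≗ν x)))
               (subst (λ w → rB w x ℕ.< rB w y) (sym (μ≗ν y))))

  SM? : ∀ μ → Dec (SM μ)
  SM? μ = injective? μ ×-dec all? (λ x → all? (λ y → ¬? (rankA x (μ y) F.<? rankA x (μ x) ×-dec
                                                         rankB (μ y) x F.<? rankB (μ y) y)))

  ≐-sym : ∀ {S T} → S ≐ T → T ≐ S
  ≐-sym S≐T μ = Prod.swap (S≐T μ)

  ≐-trans : ∀ {S T U} → S ≐ T → T ≐ U → S ≐ U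
  ≐-trans S≐T T≐U μ = proj₁ (T≐U μ) ∘ proj₁ (S≐T μ) ,
                       proj₂ (S≐T μ) ∘ proj₂ (T≐U μ)

  ≺-≼-trans : ∀ {ρ ρ' τ} → ρ ≺ ρ' → ρ' ≼ τ → ρ ≺ τ
  ≺-≼-trans (ρ≼ρ' , ρ'⋠ρ) ρ'≼τ =
    (λ μ sμ → ρ≼ρ' μ sμ ∘ ρ'≼τ μ sμ) ,
    (λ τ≼ρ → ρ'⋠ρ (λ μ sμ → ρ'≼τ μ sμ ∘ τ≼ρ μ sμ))

  separable? : ∀ τ ρ → Dec (∃ λ ξ → SM ξ × τ ∈ds ξ × ¬ ρ ∈ds ξ)
  separable? τ ρ = any-function? _
    (λ μ≗ν → Prod.map (SM-resp-≗ μ≗ν)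
               (Prod.map (∈ds-resp-≗ τ μ≗ν) (_∘ ∈ds-resp-≗ ρ (sym ∘ μ≗ν))))
    (λ ξ → SM? ξ ×-dec τ ∈ds? ξ ×-dec ¬? (ρ ∈ds? ξ))

  ¬separable⇒≼ : ∀ {τ ρ} → ¬ (∃ λ ξ → SM ξ × τ ∈ds ξ × ¬ ρ ∈ds ξ) → ρ ≼ τ
  ¬separable⇒≼ {τ} {ρ} ¬sep μ sμ τ∈μ with ρ ∈ds? μ
  ... | yes ρ∈μ = ρ∈μ
  ... | no  ρ∉μ = ⊥-elim (¬sep (μ , sμ , τ∈μ , ρ∉μ))

  applySeq-++ : ∀ xs ys S → applySeq I (xs ++ ys) S ≡ applySeq I ys (applySeq I xs S)
  applySeq-++ []       ys S = refl
  applySeq-++ (x ∷ xs) ys S = applySeq-++ xs ys (φ I x S)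

  applySeq-∈ds : ∀ L {S ξ} → S ξ → All (_∈ds ξ) L → applySeq I L S ξ
  applySeq-∈ds []      Sξ []           = Sξ
  applySeq-∈ds (τ ∷ L) Sξ (τ∈ξ ∷ L∈ξ) = applySeq-∈ds L (Sξ , λ _ → τ∈ξ) L∈ξ

  φ-unexposed : ∀ {ρ τ S ν ξ} → ρ ≺ τ → S ν → ¬ ρ ∈ds ν → S ξ → φ I τ S ξ
  φ-unexposed {ρ} {ν = ν} ρ≺τ Sν ρ∉ν Sξ =
    Sξ , λ τ-exposed → ⊥-elim (ρ∉ν (τ-exposed ρ ρ≺τ ν Sν))

  applySeq-unexposed : ∀ {ρ} L {S ν ξ} → S ν → ¬ ρ ∈ds ν → S ξ → All (ρ ≺_) L →
                       applySeq I L S ξ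
  applySeq-unexposed []      Sν ρ∉ν Sξ []            = Sξ
  applySeq-unexposed {ρ} (τ ∷ L) {S} Sν ρ∉ν Sξ (ρ≺τ ∷ ρ≺L) =
    applySeq-unexposed {ρ} L {φ I τ S} (unexposed Sν) ρ∉ν (unexposed Sξ) ρ≺L
    where
    unexposed : ∀ {μ} → S μ → φ I τ S μ
    unexposed = φ-unexposed {ρ} {τ} {S} ρ≺τ Sν ρ∉ν

  UpClosed : ASet I → Set
  UpClosed S = ∀ {μ ν} → S μ → SM ν → μ ⊑ ν → S ν

  φ-upClosed : ∀ ρ {S} → UpClosed S → UpClosed (φ I ρ S)
  φ-upClosed ρ up (Sμ , ρ∈μ) sν μ⊑ν = up Sμ sν μ⊑ν , ∈ds-mono ρ μ⊑ν ∘ ρ∈μ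

  applySeq-upClosed : ∀ L {S} → UpClosed S → UpClosed (applySeq I L S)
  applySeq-upClosed []      up = up
  applySeq-upClosed (ρ ∷ L) up = applySeq-upClosed L (φ-upClosed ρ up)

  upClosed-¬singleton : ∀ {S} → UpClosed S → ∀ ρ {ν} → SM ν → S ν → ¬ ρ ∈ds ν →
                        ¬ Singleton I S
  upClosed-¬singleton up ρ {ν} sν Sν ρ∉ν (μ , _ , unique)
    with ζ , sζ , ρ∈ζ ← RotationFacts.∈ds-witness ρ =
    ρ∉ν (∈ds-resp-≗ ρ (λ a → trans (unique (ν ⊔ ζ) Sν⊔ζ a) (sym (unique ν Sν a)))
                      (∈ds-mono ρ (⊔-upperʳ ν ζ) ρ∈ζ))
    where
    Sν⊔ζ = up Sν (⊔-stable sν sζ) (⊔-upperˡ ν ζ)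

  module OneLayer {ρ ρ'} (ρ≺ρ' : ρ ≺ ρ') {ν} (sν : SM ν) (ρ∉ν : ¬ ρ ∈ds ν) where

    record Split (L : List (Rotation I)) : Set where
      field
        blocked applied : List (Rotation I)
        reorder   : blocked ++ applied ↭ L
        ρ≺blocked : All (ρ ≺_) blocked
        ξ         : Matching I
        ξ-stable  : SM ξ
        ν⊑ξ       : ν ⊑ ξ
        ρ'∉ξ      : ¬ ρ' ∈ds ξ
        applied∈ξ : All (_∈ds ξ) applied

    split : ∀ L → Split L
    split [] = record
      { blocked = [] ; applied = [] ; reorder = _↭_.refl ; ρ≺blocked = []
      ; ξ = ν ; ξ-stable = sν ; ν⊑ξ = ⊑-refl ; ρ'∉ξ = ρ∉ν ∘ proj₁ ρ≺ρ' ν sν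
      ; applied∈ξ = [] }
    split (τ ∷ L) with split L | separable? τ ρ'
    ... | s | yes (ζ , sζ , τ∈ζ , ρ'∉ζ) = record
      { blocked = blocked ; applied = τ ∷ applied
      ; reorder = ↭-trans (shift τ blocked applied) (prep τ reorder) ; ρ≺blocked = ρ≺blocked
      ; ξ = ξ ⊔ ζ ; ξ-stable = ⊔-stable ξ-stable sζ ; ν⊑ξ = ⊑-trans ν⊑ξ (⊔-upperˡ ξ ζ)
      ; ρ'∉ξ = RotationFacts.∉ds-⊔ ρ' ξ-stable sζ ρ'∉ξ ρ'∉ζ
      ; applied∈ξ = ∈ds-mono τ (⊔-upperʳ ξ ζ) τ∈ζ ∷
                    All.map (λ {σ} → ∈ds-mono σ (⊔-upperˡ ξ ζ)) applied∈ξ }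
      where open Split s
    ... | s | no ¬sep = record
      { blocked = τ ∷ blocked ; applied = applied ; reorder = prep τ reorder
      ; ρ≺blocked = ≺-≼-trans {ρ} {ρ'} {τ} ρ≺ρ' (¬separable⇒≼ {τ} {ρ'} ¬sep) ∷ ρ≺blocked
      ; ξ = ξ ; ξ-stable = ξ-stable ; ν⊑ξ = ν⊑ξ ; ρ'∉ξ = ρ'∉ξ ; applied∈ξ = applied∈ξ }
      where open Split s

    survivor : ∀ L {S} → UpClosed S → S ν → (∀ L' → L' ↭ L → applySeq I L' S ≐ applySeq I L S) →
               ∃ λ ξ → SM ξ × applySeq I L S ξ × ¬ ρ' ∈ds ξ
    survivor L {S} up Sν commutes = ξ , ξ-stable , proj₁ (commutes _ reorder ξ) in-reordered , ρ'∉ξ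
      where
      open Split (split L)
      in-reordered : applySeq I (blocked ++ applied) S ξ
      in-reordered = subst (λ T → T ξ) (sym (applySeq-++ blocked applied S))
        (applySeq-∈ds applied
          (applySeq-unexposed {ρ} blocked {S} Sν ρ∉ν (up Sν ξ-stable ν⊑ξ) ρ≺blocked) applied∈ξ)

  chain-below-layers : ∀ ρ c Ls {S} → UpClosed S → IsChain I (ρ ∷ c) → LayersOK I S Ls →
                       Singleton I (applySeq I (concat Ls) S) →
                       ∀ {ν} → SM ν → S ν → ¬ ρ ∈ds ν → length (ρ ∷ c) ℕ.≤ length Ls
  chain-below-layers ρ c [] up _ _ single sν Sν ρ∉ν =
    ⊥-elim (upClosed-¬singleton up ρ sν Sν ρ∉ν single)
  chain-below-layers ρ [] (L ∷ Ls) _ _ _ _ _ _ _ = s≤s z≤n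
  chain-below-layers ρ (ρ' ∷ c) (L ∷ Ls) {S} up (ρ≺ρ' ∷ chain) (commutes , layers)
                     single sν Sν ρ∉ν
    with ξ , sξ , Sξ , ρ'∉ξ ← OneLayer.survivor {ρ} {ρ'} ρ≺ρ' sν ρ∉ν L up Sν commutes =
    s≤s (chain-below-layers ρ' c Ls (applySeq-upClosed L up) chain layers
           (subst (Singleton I) (applySeq-++ L (concat Ls) S) single) sξ Sξ ρ'∉ξ)

  chain≤depth : ∀ c Ls → IsChain I c → ValidLayering I Ls → length c ℕ.≤ length Ls
  chain≤depth []      Ls _     _                   = z≤n
  chain≤depth (ρ ∷ c) Ls chain (_ , single , layers) =
    chain-below-layers ρ c Ls (λ _ sν _ → sν) chain layers single μρ-stable μρ-stable ∉ds-μρ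
    where open RotationFacts ρ

  -- A predecessor σ of ρ not yet eliminated in κ would have its first man moved between κ and κ', so he
  -- lies on ρ, and all-or-nothing then gives ρ ≼ σ.
  predecessors-∈ds : ∀ ρ {κ κ'} → SM κ → SM κ' → ρ ∈ds κ' →
                     (∀ x → κ' x ≢ κ x → ∃ λ l → Rotation.as ρ l ≡ x × κ x ≡ Rotation.bs ρ l) →
                     ∀ σ → σ ≺ ρ → σ ∈ds κ
  predecessors-∈ds ρ {κ} {κ'} sκ sκ' ρ∈κ' only-ρ-moves σ (σ≼ρ , ρ⋠σ) with σ ∈ds? κ
  ... | yes σ∈κ = σ∈κ
  ... | no  σ∉κ = ⊥-elim (ρ⋠σ (ρ≼σ (only-ρ-moves a κ'a≢κa)))
    where
    open Rotation σ using () renaming (as to asσ; bs to bsσ)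
    a = asσ F.zero
    κa≤b : rA a (κ a) ℕ.≤ rA a (bsσ F.zero)
    κa≤b = RotationFacts.∉ds⇒not-passed σ sκ σ∉κ F.zero
    κ'a≢κa : κ' a ≢ κ a
    κ'a≢κa eq = ℕP.<⇒≱ (σ≼ρ κ' sκ' ρ∈κ' F.zero)
                       (subst (λ w → rA a w ℕ.≤ rA a (bsσ F.zero)) (sym eq) κa≤b)
    ρ≼σ : (∃ λ l → Rotation.as ρ l ≡ a × κ a ≡ Rotation.bs ρ l) → ρ ≼ σ
    ρ≼σ (l , asl≡a , κa≡bl) μ sμ σ∈μ = RotationFacts.all-or-nothing ρ sμ l
      (subst (λ x → rA x (Rotation.bs ρ l) ℕ.< rA x (μ x)) (sym asl≡a)
        (subst (λ w → rA a w ℕ.< rA a (μ a)) κa≡bl (ℕP.≤-<-trans κa≤b (σ∈μ F.zero))))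

  ⨆ : Matching I → List (Matching I) → Matching I
  ⨆ κ = foldr _⊔_ κ

  ⨆-stable : ∀ {κ} μs → SM κ → All SM μs → SM (⨆ κ μs)
  ⨆-stable []       sκ []          = sκ
  ⨆-stable (μ ∷ μs) sκ (sμ ∷ sμs) = ⊔-stable sμ (⨆-stable μs sκ sμs)

  ⨆-base : ∀ {κ} μs → κ ⊑ ⨆ κ μs
  ⨆-base []       = ⊑-refl
  ⨆-base (μ ∷ μs) = ⊑-trans (⨆-base μs) (⊔-upperʳ μ _)

  ⨆-upper : ∀ {κ μ} μs → μ ∈ μs → μ ⊑ ⨆ κ μs
  ⨆-upper (μ ∷ μs) (here refl) = ⊔-upperˡ μ _
  ⨆-upper (ν ∷ μs) (there μ∈) = ⊑-trans (⨆-upper μs μ∈) (⊔-upperʳ ν _)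

  ⨆-least : ∀ {κ ξ} μs → κ ⊑ ξ → All (_⊑ ξ) μs → ⨆ κ μs ⊑ ξ
  ⨆-least []       κ⊑ξ []            = κ⊑ξ
  ⨆-least (μ ∷ μs) κ⊑ξ (μ⊑ξ ∷ μs⊑ξ) = ⊔-least μ⊑ξ (⨆-least μs κ⊑ξ μs⊑ξ)

  ⨆-sel : ∀ {κ} μs x → ⨆ κ μs x ≡ κ x ⊎ ∃ λ μ → μ ∈ μs × ⨆ κ μs x ≡ μ x
  ⨆-sel []       x = inj₁ refl
  ⨆-sel (μ ∷ μs) x with ⊔-sel μ (⨆ _ μs) x
  ... | inj₁ eq = inj₂ (μ , here refl , eq)
  ... | inj₂ eq = Sum.map (trans eq) (Prod.map₂ (Prod.map there (trans eq))) (⨆-sel μs x)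

  applySeq-exposed : ∀ L {S κ} → (∀ {μ} → S μ → κ ⊑ μ) →
                     All (λ ρ → ∀ σ → σ ≺ ρ → σ ∈ds κ) L →
                     applySeq I L S ≐ λ μ → S μ × All (_∈ds μ) L
  applySeq-exposed []      _   []  μ = (_, []) , proj₁
  applySeq-exposed (ρ ∷ L) {S} S⊒κ (ρ-exposed ∷ L-exposed) μ
    with to , from ← applySeq-exposed L {φ I ρ S} (S⊒κ ∘ proj₁) L-exposed μ =
    (λ x → let (Sμ , filter) , L∈μ = to x in Sμ , filter exposed ∷ L∈μ) ,
    (λ { (Sμ , ρ∈μ ∷ L∈μ) → from ((Sμ , λ _ → ρ∈μ) , L∈μ) })
    where
    exposed : Exposed I ρ S
    exposed σ σ≺ρ ν Sν = ∈ds-mono σ (S⊒κ Sν) (ρ-exposed σ σ≺ρ)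

  Up : Matching I → ASet I
  Up κ μ = SM μ × κ ⊑ μ

  rankSum : Matching I → ℕ
  rankSum μ = sumᶠ (λ a → rA a (μ a))

  rankSum≤n*n : ∀ μ → rankSum μ ℕ.≤ n * n
  rankSum≤n*n μ = sumᶠ-≤-* (λ a → ℕP.<⇒≤ (FP.toℕ<n (rankA a (μ a))))

  -- FirstWilling a b says that b is s_κ(a); next is a ↦ κ⁻¹(s_κ(a)), extended by the identity where s_κ(a)
  -- is undefined.
  module AtMatching {κ : Matching I} (sκ : SM κ) where

    κ⁻¹ : Fin n → Fin n
    κ⁻¹ = inverse κ (proj₁ sκ)

    κκ⁻¹ : ∀ b → κ (κ⁻¹ b) ≡ b
    κκ⁻¹ = inverseʳ κ (proj₁ sκ)

    κ⁻¹κ : ∀ a → κ⁻¹ (κ a) ≡ a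
    κ⁻¹κ = inverseˡ κ (proj₁ sκ)

    Willing : Fin n → Fin n → Set
    Willing a b = rA a (κ a) ℕ.< rA a b × rB b a ℕ.< rB b (κ⁻¹ b)

    willing? : ∀ a b → Dec (Willing a b)
    willing? a b = rA a (κ a) ℕ.<? rA a b ×-dec rB b a ℕ.<? rB b (κ⁻¹ b)

    FirstWilling : Fin n → Fin n → Set
    FirstWilling a b = Willing a b × (∀ c → Willing a c → rA a b ℕ.≤ rA a c)

    firstWilling-unique : ∀ {a b c} → FirstWilling a b → FirstWilling a c → b ≡ c
    firstWilling-unique {a} (wb , b-first) (wc , c-first) =
      rA-injective a (ℕP.≤-antisym (b-first _ wc) (c-first _ wb))

    willing⇒firstWilling : ∀ {a b} → Willing a b → ∃ (FirstWilling a)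
    willing⇒firstWilling {a} {b} wb with argmin? (rA a) (willing? a)
    ... | inj₁ first = first
    ... | inj₂ none  = ⊥-elim (none b wb)

    willing⇒κ⁻¹≢ : ∀ {a b} → Willing a b → κ⁻¹ b ≢ a
    willing⇒κ⁻¹≢ {a} {b} (later , _) κ⁻¹b≡a =
      ℕP.<-irrefl (cong (rA a) (trans (cong κ (sym κ⁻¹b≡a)) (κκ⁻¹ b))) later

    opaque
      next : Fin n → Fin n
      next a with argmin? (rA a) (willing? a)
      ... | inj₁ (b , _) = κ⁻¹ b
      ... | inj₂ _       = a

      next-firstWilling : ∀ {a b} → FirstWilling a b → next a ≡ κ⁻¹ b
      next-firstWilling {a} fb with argmin? (rA a) (willing? a)
      ... | inj₁ (_ , fb') = cong κ⁻¹ (firstWilling-unique fb' fb)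
      ... | inj₂ none      = ⊥-elim (none _ (proj₁ fb))

      next-unwilling : ∀ {a} → (∀ b → ¬ Willing a b) → next a ≡ a
      next-unwilling {a} none with argmin? (rA a) (willing? a)
      ... | inj₁ (b , fb) = ⊥-elim (none b (proj₁ fb))
      ... | inj₂ _        = refl

    κ-next : ∀ {a b} → FirstWilling a b → κ (next a) ≡ b
    κ-next fb = trans (cong κ (next-firstWilling fb)) (κκ⁻¹ _)

    stablePartner⇒willing : ∀ {x c} → StablePair I x c → rA x (κ x) ℕ.< rA x c → Willing x c
    stablePartner⇒willing {x} {c} (ν , sν , νx≡c) later = later , c-prefers-x
      where
      y = κ⁻¹ c
      ξ = ν ⊔ κ
      sξ = ⊔-stable sν sκ
      y≢x : y ≢ x
      y≢x y≡x = ℕP.<-irrefl (cong (rA x) (trans (cong κ (sym y≡x)) (κκ⁻¹ c))) later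
      ξx≡c : ξ x ≡ c
      ξx≡c = trans (⊔-≡ˡ ν κ x (subst (λ w → rA x (κ x) ℕ.≤ rA x w) (sym νx≡c) (ℕP.<⇒≤ later)))
                   νx≡c
      y-covets : rA y (ξ x) ℕ.< rA y (ξ y)
      y-covets = subst (λ w → rA y w ℕ.< rA y (ξ y)) (sym ξx≡c)
        (rA-≤∧≢⇒< y (λ c≡ξy → y≢x (proj₁ sξ (trans (sym c≡ξy) (sym ξx≡c))))
           (subst (λ w → rA y w ℕ.≤ rA y (ξ y)) (κκ⁻¹ c) (⊔-upperʳ ν κ y)))
      c-prefers-x : rB c x ℕ.< rB c y
      c-prefers-x = subst (λ w → rB w x ℕ.< rB w y) ξx≡c (stable⇒rival-rejected sξ y x y-covets y≢x)

    OnCycle : Fin n → Set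
    OnCycle a = ∃ (Willing a) × ∃ λ (p : Fin n) → fold a next (suc (toℕ p)) ≡ a

    onCycle? : ∀ a → Dec (OnCycle a)
    onCycle? a = any? (willing? a) ×-dec any? (λ p → fold a next (suc (toℕ p)) FP.≟ a)

    module Toward {τ} (sτ : SM τ) (κ⊑τ : κ ⊑ τ) where

      Moving : Fin n → Set
      Moving a = κ a ≢ τ a

      moving⇒willing : ∀ {a} → Moving a → Willing a (τ a)
      moving⇒willing {a} moves = stablePartner⇒willing (τ , sτ , refl) (rA-≤∧≢⇒< a moves (κ⊑τ a))

      moving-next : ∀ {a} → Moving a → Moving (next a)
      moving-next {a} moves with b , fb ← willing⇒firstWilling (moving⇒willing moves) =
        subst Moving (sym (next-firstWilling fb)) a'-moves
        where
        a' = κ⁻¹ b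
        a'-moves : Moving a'
        a'-moves κa'≡τa' = proj₂ sτ a a' (a-covets , b-prefers-a)
          where
          τa'≡b : τ a' ≡ b
          τa'≡b = trans (sym κa'≡τa') (κκ⁻¹ b)
          b≢τa : b ≢ τ a
          b≢τa b≡τa = willing⇒κ⁻¹≢ (proj₁ fb) (proj₁ sτ (trans τa'≡b b≡τa))
          a-covets : rA a (τ a') ℕ.< rA a (τ a)
          a-covets = subst (λ w → rA a w ℕ.< rA a (τ a)) (sym τa'≡b)
            (rA-≤∧≢⇒< a b≢τa (proj₂ fb (τ a) (moving⇒willing moves)))
          b-prefers-a : rB (τ a') a ℕ.< rB (τ a') a'
          b-prefers-a = subst (λ w → rB w a ℕ.< rB w a') (sym τa'≡b) (proj₂ (proj₁ fb))

      moving⇒onCycle : ∀ {a} → Moving a → ∃ OnCycle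
      moving⇒onCycle {a} moves with i , d , cycle ← eventually-periodic next a =
        fold a next i , (τ _ , moving⇒willing (fold-closed next Moving moving-next i moves)) , d , cycle

    record ExposedRotation : Set where
      field
        ρ              : Rotation I
        κ-matches      : ∀ j → κ (Rotation.as ρ j) ≡ Rotation.bs ρ j
        firstWilling   : ∀ j → FirstWilling (Rotation.as ρ j) (Rotation.bs ρ (csuc j))
        κ/ρ            : Matching I
        κ/ρ-stable     : SM κ/ρ
        ρ∈ds-κ/ρ       : ρ ∈ds κ/ρ
        κ/ρ-least      : ∀ ξ → SM ξ → κ ⊑ ξ → ρ ∈ds ξ → κ/ρ ⊑ ξ
        κ/ρ-moves-only : ∀ x → κ/ρ x ≢ κ x →
                         ∃ λ l → Rotation.as ρ l ≡ x × κ x ≡ Rotation.bs ρ l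
        predecessors   : ∀ σ → σ ≺ ρ → σ ∈ds κ

    module Eliminate {a} (a-willing : ∃ (Willing a)) {k} (period : fold a next (suc k) ≡ a)
                     (minimal : ∀ q → q ℕ.< k → fold a next (suc q) ≢ a) where

      as : Fin (suc k) → Fin n
      as i = fold a next (toℕ i)

      bs : Fin (suc k) → Fin n
      bs = κ ∘ as

      as-csuc : ∀ i → as (csuc i) ≡ next (as i)
      as-csuc i with last-or-inject₁ i
      ... | inj₁ refl = trans (cong as (csuc-fromℕ k))
        (trans (sym period) (cong (λ t → fold a next (suc t)) (sym (FP.toℕ-fromℕ k))))
      ... | inj₂ (j , refl) = trans (cong as (csuc-inject₁ j))
        (cong (λ t → next (fold a next t)) (sym (FP.toℕ-inject₁ j)))

      as-injective : Injective _≡_ _≡_ as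
      as-injective {i} {j} eq with ℕP.<-cmp (toℕ i) (toℕ j)
      ... | tri< i<j _ _ = ⊥-elim (fold-injective-within-period next minimal period i<j (FP.toℕ≤pred[n] j) eq)
      ... | tri≈ _ i≡j _ = toℕ-injective i≡j
      ... | tri> _ _ j<i =
        ⊥-elim (fold-injective-within-period next minimal period j<i (FP.toℕ≤pred[n] i) (sym eq))

      as-willing : ∀ i → ∃ (Willing (as i))
      as-willing i with any? (willing? (as i))
      ... | yes willing = willing
      ... | no ¬willing = ⊥-elim (¬willing (subst (∃ ∘ Willing) a≡asi a-willing))
        where
        fixed : next (as i) ≡ as i
        fixed = next-unwilling (λ b w → ¬willing (b , w))
        a≡asi : a ≡ as i
        a≡asi = cyclic-induction (λ j → as j ≡ as i)
                  (λ j eq → trans (as-csuc j) (trans (cong next eq) fixed)) {i} refl F.zero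

      as-firstWilling : ∀ i → FirstWilling (as i) (bs (csuc i))
      as-firstWilling i with b , fb ← willing⇒firstWilling (proj₂ (as-willing i)) =
        subst (FirstWilling (as i)) (sym (trans (cong κ (as-csuc i)) (κ-next fb))) fb

      OnRotation : Fin n → Set
      OnRotation x = ∃ λ i → as i ≡ x

      onRotation? : ∀ x → Dec (OnRotation x)
      onRotation? x = any? (λ i → as i FP.≟ x)

      opaque
        advance : Fin n → Fin n
        advance x with onRotation? x
        ... | yes _ = next x
        ... | no  _ = x

        advance-on : ∀ {x} → OnRotation x → advance x ≡ next x
        advance-on {x} on with onRotation? x
        ... | yes _  = refl
        ... | no off = ⊥-elim (off on)

        advance-off : ∀ {x} → ¬ OnRotation x → advance x ≡ x
        advance-off {x} off with onRotation? x
        ... | yes on = ⊥-elim (off on)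
        ... | no _   = refl

      advance-as : ∀ i → advance (as i) ≡ as (csuc i)
      advance-as i = trans (advance-on (i , refl)) (sym (as-csuc i))

      advance-injective : Injective _≡_ _≡_ advance
      advance-injective {x} {y} eq = cases (onRotation? x) (onRotation? y)
        where
        cases : Dec (OnRotation x) → Dec (OnRotation y) → x ≡ y
        cases (yes (i , refl)) (yes (j , refl)) =
          cong as (csuc-injective (as-injective (trans (sym (advance-as i)) (trans eq (advance-as j)))))
        cases (yes (i , refl)) (no off) =
          ⊥-elim (off (csuc i , trans (sym (advance-as i)) (trans eq (advance-off off))))
        cases (no off) (yes (j , refl)) =
          ⊥-elim (off (csuc j , trans (sym (advance-as j)) (trans (sym eq) (advance-off off))))
        cases (no offx) (no offy) = trans (sym (advance-off offx)) (trans eq (advance-off offy))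

      κ/ρ : Matching I
      κ/ρ = κ ∘ advance

      κ/ρ-as : ∀ i → κ/ρ (as i) ≡ bs (csuc i)
      κ/ρ-as i = cong κ (advance-as i)

      κ/ρ-firstWilling : ∀ {x} → OnRotation x → FirstWilling x (κ/ρ x)
      κ/ρ-firstWilling (i , refl) = subst (FirstWilling (as i)) (sym (κ/ρ-as i)) (as-firstWilling i)

      κ/ρ-favours-women : ∀ y → rB (κ/ρ y) y ℕ.≤ rB (κ/ρ y) (κ⁻¹ (κ/ρ y))
      κ/ρ-favours-women y with onRotation? y
      ... | yes on = ℕP.<⇒≤ (proj₂ (proj₁ (κ/ρ-firstWilling on)))
      ... | no off rewrite advance-off off = ℕP.≤-reflexive (cong (rB (κ y)) (sym (κ⁻¹κ y)))

      κ/ρ-stable : SM κ/ρ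
      κ/ρ-stable = advance-injective ∘ proj₁ sκ , unblocked
        where
        unblocked : Stable I κ/ρ
        unblocked x y (x-covets , x-preferred) = by-cases (ℕP.<-cmp (rA x w) (rA x (κ x)))
          where
          w = κ/ρ y
          w-prefers-x : rB w x ℕ.< rB w (κ⁻¹ w)
          w-prefers-x = ℕP.<-≤-trans x-preferred (κ/ρ-favours-women y)
          beyond : Dec (OnRotation x) → rA x (κ x) ℕ.< rA x w → ⊥
          beyond (yes on) later = ℕP.<⇒≱ x-covets (proj₂ (κ/ρ-firstWilling on) w (later , w-prefers-x))
          beyond (no off) later =
            ℕP.<-asym later (subst (λ v → rA x w ℕ.< rA x (κ v)) (advance-off off) x-covets)
          by-cases : Tri (rA x w ℕ.< rA x (κ x)) (rA x w ≡ rA x (κ x)) (rA x (κ x) ℕ.< rA x w) → ⊥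
          by-cases (tri< earlier _ _) = proj₂ sκ x (κ⁻¹ w)
            (subst (λ v → rA x v ℕ.< rA x (κ x)) (sym (κκ⁻¹ w)) earlier ,
             subst (λ v → rB v x ℕ.< rB v (κ⁻¹ w)) (sym (κκ⁻¹ w)) w-prefers-x)
          by-cases (tri≈ _ same _) =
            ℕP.<-irrefl (cong (rB w) (sym (trans (cong κ⁻¹ (rA-injective x same)) (κ⁻¹κ x)))) w-prefers-x
          by-cases (tri> _ _ later) = beyond (onRotation? x) later

      rotation : Rotation I
      rotation = record
        { k = k ; as = as ; bs = bs ; distinct = as-injective ; matched = κ , sκ , (λ _ → refl)
        ; next = λ i → proj₁ (proj₁ (as-firstWilling i)) , (κ/ρ , κ/ρ-stable , κ/ρ-as i) ,
                       λ c c-stable later → proj₂ (as-firstWilling i) c (stablePartner⇒willing c-stable later) }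

      κ/ρ-least : ∀ ξ → SM ξ → κ ⊑ ξ → rotation ∈ds ξ → κ/ρ ⊑ ξ
      κ/ρ-least ξ sξ κ⊑ξ ρ∈ξ x with onRotation? x
      ... | yes (i , refl) = proj₂ (κ/ρ-firstWilling (i , refl)) (ξ x)
                               (stablePartner⇒willing (ξ , sξ , refl) (ρ∈ξ i))
      ... | no off rewrite advance-off off = κ⊑ξ x

      κ/ρ-moves-only : ∀ x → κ/ρ x ≢ κ x → ∃ λ l → as l ≡ x × κ x ≡ bs l
      κ/ρ-moves-only x moved with onRotation? x
      ... | yes (l , refl) = l , refl , refl
      ... | no off = ⊥-elim (moved (cong κ (advance-off off)))

      rotation∈ds-κ/ρ : rotation ∈ds κ/ρ
      rotation∈ds-κ/ρ i = subst (λ w → rA (as i) (bs i) ℕ.< rA (as i) w) (sym (κ/ρ-as i))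
                                (proj₁ (proj₁ (as-firstWilling i)))

      exposedRotation : ExposedRotation
      exposedRotation = record
        { ρ = rotation ; κ-matches = λ _ → refl ; firstWilling = as-firstWilling
        ; κ/ρ = κ/ρ ; κ/ρ-stable = κ/ρ-stable ; ρ∈ds-κ/ρ = rotation∈ds-κ/ρ
        ; κ/ρ-least = κ/ρ-least ; κ/ρ-moves-only = κ/ρ-moves-only
        ; predecessors = predecessors-∈ds rotation sκ κ/ρ-stable rotation∈ds-κ/ρ κ/ρ-moves-only }

    eliminate : ∀ {a} → OnCycle a → Σ ExposedRotation λ e → Rotation.as (ExposedRotation.ρ e) F.zero ≡ a
    eliminate {a} (willing , p , cycle) with argmin? toℕ (λ q → fold a next (suc (toℕ q)) FP.≟ a)
    ... | inj₂ none = ⊥-elim (none p cycle)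
    ... | inj₁ (d , period , shortest) = Eliminate.exposedRotation willing period minimal , refl
      where
      minimal : ∀ q → q ℕ.< toℕ d → fold a next (suc q) ≢ a
      minimal q q<d eq = ℕP.<⇒≱ q<d (subst (toℕ d ℕ.≤_) (FP.toℕ-fromℕ< q<n)
        (shortest (fromℕ< q<n) (subst (λ t → fold a next (suc t) ≡ a) (sym (FP.toℕ-fromℕ< q<n)) eq)))
        where q<n = ℕP.<-trans q<d (FP.toℕ<n d)

    open ExposedRotation

    rotationsFrom : ∀ a → Dec (OnCycle a) → List ExposedRotation
    rotationsFrom a (yes c) = proj₁ (eliminate c) ∷ []
    rotationsFrom a (no _)  = []

    layer : List ExposedRotation
    layer = concatMap (λ a → rotationsFrom a (onCycle? a)) (allFin n)

    layer-covers : ∀ {a} → OnCycle a → ∃ λ e → e ∈ layer × Rotation.as (ρ e) F.zero ≡ a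
    layer-covers {a} c = widen (from (onCycle? a))
      where
      Starting : List ExposedRotation → Set
      Starting es = ∃ λ e → e ∈ es × Rotation.as (ρ e) F.zero ≡ a
      from : (d : Dec (OnCycle a)) → Starting (rotationsFrom a d)
      from (yes c') = proj₁ (eliminate c') , here refl , proj₂ (eliminate c')
      from (no ¬c)  = ⊥-elim (¬c c)
      widen : Starting (rotationsFrom a (onCycle? a)) → Starting layer
      widen (e , e∈ , starts) =
        e , ∈-concatMap⁺ (λ a → rotationsFrom a (onCycle? a)) (Any.map (λ { refl → e∈ }) (∈-allFin a)) ,
        starts

    layerRotations : List (Rotation I)
    layerRotations = map ρ layer

    κ' : Matching I
    κ' = ⨆ κ (map κ/ρ layer)

    κ'-stable : SM κ'
    κ'-stable = ⨆-stable (map κ/ρ layer) sκ (All.map⁺ (All.tabulate (λ {e} _ → κ/ρ-stable e)))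

    κ⊑κ' : κ ⊑ κ'
    κ⊑κ' = ⨆-base (map κ/ρ layer)

    κ/ρ⊑κ' : ∀ {e} → e ∈ layer → κ/ρ e ⊑ κ'
    κ/ρ⊑κ' e∈ = ⨆-upper (map κ/ρ layer) (∈-map⁺ κ/ρ e∈)

    ρ∈ds-κ' : ∀ {e} → e ∈ layer → ρ e ∈ds κ'
    ρ∈ds-κ' {e} e∈ = ∈ds-mono (ρ e) (κ/ρ⊑κ' e∈) (ρ∈ds-κ/ρ e)

    applyLayer : ∀ L {S} → S ≐ Up κ → L ↭ layerRotations → applySeq I L S ≐ Up κ'
    applyLayer L {S} S≐Up reorder μ =
      (λ in-L → to (proj₁ (applied μ) in-L)) , (λ in-Up → proj₂ (applied μ) (from in-Up))
      where
      applied = applySeq-exposed L (proj₂ ∘ proj₁ (S≐Up _))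
        (All-resp-↭ (↭-sym reorder) (All.map⁺ (All.tabulate (λ {e} _ → predecessors e))))
      to : S μ × All (_∈ds μ) L → Up κ' μ
      to (Sμ , L∈μ) = sμ , ⨆-least (map κ/ρ layer) κ⊑μ (All.map⁺ (All.tabulate λ {e} e∈ →
          κ/ρ-least e μ sμ κ⊑μ (All.lookup (All.map⁻ (All-resp-↭ reorder L∈μ)) e∈)))
        where
        sμ = proj₁ (proj₁ (S≐Up μ) Sμ)
        κ⊑μ = proj₂ (proj₁ (S≐Up μ) Sμ)
      from : Up κ' μ → S μ × All (_∈ds μ) L
      from (sμ , κ'⊑μ) = proj₂ (S≐Up μ) (sμ , ⊑-trans κ⊑κ' κ'⊑μ) ,
        All-resp-↭ (↭-sym reorder)
          (All.map⁺ (All.tabulate (λ {e} e∈ → ∈ds-mono (ρ e) κ'⊑μ (ρ∈ds-κ' e∈))))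

    κ'-advances : ∀ {a} → OnCycle a → rA a (κ a) ℕ.< rA a (κ' a)
    κ'-advances c with e , e∈ , starts ← layer-covers c =
      subst (λ x → rA x (κ x) ℕ.< rA x (κ' x)) starts
        (subst (λ w → rA a₀ w ℕ.< rA a₀ (κ' a₀)) (sym (κ-matches e F.zero)) (ρ∈ds-κ' e∈ F.zero))
      where a₀ = Rotation.as (ρ e) F.zero

    progress : ∀ {a} → OnCycle a → rankSum κ ℕ.< rankSum κ'
    progress {a} c = sumᶠ-mono-< κ⊑κ' a (κ'-advances c)

    stuck : (∀ a → ¬ OnCycle a) → ∀ {ν} → Up κ ν → ν ≗ κ
    stuck none {ν} (sν , κ⊑ν) a with κ a FP.≟ ν a
    ... | yes same = sym same
    ... | no moves = ⊥-elim (none _ (proj₂ (Toward.moving⇒onCycle sν κ⊑ν moves)))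

  rotation-length≤n : ∀ (ρ : Rotation I) → suc (Rotation.k ρ) ℕ.≤ n
  rotation-length≤n ρ = FP.injective⇒≤ (Rotation.distinct ρ)

  -- If some man of ρ' moved in the layer at κ, or some man of ρ' has an earlier willing woman in κ than in
  -- κ' (so that her κ-partner moved), the rotation that moved that man precedes ρ'.  Otherwise ρ' is
  -- already a cycle of next in κ, so the layer at κ eliminated it, contradicting ρ' ∉ ds(κ').
  module LayerPredecessor {κ} (sκ : SM κ) (e' : AtMatching.ExposedRotation (AtMatching.κ'-stable sκ)) where
    open AtMatching sκ
    open ExposedRotation
    module Next = AtMatching κ'-stable
    open Next.ExposedRotation e' using () renaming (ρ to ρ'; κ-matches to κ'-matches; firstWilling to firstWilling')
    open Rotation ρ' using () renaming (as to as'; bs to bs'; k to k')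
    open RotationFacts ρ' using () renaming (next-first to next-first')

    HasPredecessor : Set
    HasPredecessor = ∃ λ e → e ∈ layer × ρ e ≺ ρ'

    ρ'⋠layer : ∀ {e} → e ∈ layer → ¬ ρ' ≼ ρ e
    ρ'⋠layer {e} e∈ ρ'≼ρ = ℕP.<⇒≱ (ρ'≼ρ (κ/ρ e) (κ/ρ-stable e) (ρ∈ds-κ/ρ e) F.zero)
      (subst (λ w → rA a₀ (κ/ρ e a₀) ℕ.≤ rA a₀ w) (κ'-matches F.zero) (κ/ρ⊑κ' e∈ a₀))
      where a₀ = as' F.zero

    mover-precedes : ∀ {y} → κ' y ≢ κ y → (∀ μ → SM μ → ρ' ∈ds μ → rA y (κ y) ℕ.< rA y (μ y)) →
                     HasPredecessor
    mover-precedes {y} moved passes with ⨆-sel (map κ/ρ layer) y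
    ... | inj₁ same = ⊥-elim (moved same)
    ... | inj₂ (μ , μ∈ , κ'y≡μy) with e , e∈ , refl ← ∈-map⁻ κ/ρ μ∈
                                 with l , asl≡y , κy≡bl ← κ/ρ-moves-only e y (moved ∘ trans κ'y≡μy) =
      e , e∈ , ρ≼ρ' , ρ'⋠layer e∈
      where
      ρ≼ρ' : ρ e ≼ ρ'
      ρ≼ρ' μ sμ ρ'∈μ = RotationFacts.all-or-nothing (ρ e) sμ l
        (subst (λ x → rA x (Rotation.bs (ρ e) l) ℕ.< rA x (μ x)) (sym asl≡y)
          (subst (λ w → rA y w ℕ.< rA y (μ y)) κy≡bl (passes μ sμ ρ'∈μ)))

    moved-on-ρ' : ∀ j → κ (as' j) ≢ bs' j → HasPredecessor
    moved-on-ρ' j κx≢b = mover-precedes (λ eq → κx≢b (trans (sym eq) (κ'-matches j))) passes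
      where
      x = as' j
      passes : ∀ μ → SM μ → ρ' ∈ds μ → rA x (κ x) ℕ.< rA x (μ x)
      passes μ _ ρ'∈μ =
        ℕP.≤-<-trans (subst (λ w → rA x (κ x) ℕ.≤ rA x w) (κ'-matches j) (κ⊑κ' x)) (ρ'∈μ j)

    module _ (ρ'-in-κ : ∀ j → κ (as' j) ≡ bs' j) where

      κ'≡κ-on-ρ' : ∀ j → κ' (as' j) ≡ κ (as' j)
      κ'≡κ-on-ρ' j = trans (κ'-matches j) (sym (ρ'-in-κ j))

      κ⁻¹≡κ'⁻¹-on-ρ' : ∀ j → κ⁻¹ (bs' j) ≡ Next.κ⁻¹ (bs' j)
      κ⁻¹≡κ'⁻¹-on-ρ' j = trans (cong κ⁻¹ (sym (ρ'-in-κ j))) (trans (κ⁻¹κ (as' j))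
                           (sym (trans (cong Next.κ⁻¹ (sym (κ'-matches j))) (Next.κ⁻¹κ (as' j)))))

      earlier-willing : ∀ j c → Willing (as' j) c → rA (as' j) c ℕ.< rA (as' j) (bs' (csuc j)) →
                        HasPredecessor
      earlier-willing j c (c-later , c-prefers-x) c-earlier = mover-precedes y-moved passes
        where
        x = as' j
        y = κ⁻¹ c
        κy≡c = κκ⁻¹ c
        y-moved : κ' y ≢ κ y
        y-moved κ'y≡κy = ℕP.<⇒≱ c-earlier (proj₂ (firstWilling' j) c (κ'-later , κ'-prefers))
          where
          κ'-later : rA x (κ' x) ℕ.< rA x c
          κ'-later = subst (λ w → rA x w ℕ.< rA x c) (sym (κ'≡κ-on-ρ' j)) c-later
          κ'-prefers : rB c x ℕ.< rB c (Next.κ⁻¹ c)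
          κ'-prefers = subst (λ z → rB c x ℕ.< rB c z)
            (sym (trans (cong Next.κ⁻¹ (sym (trans κ'y≡κy κy≡c))) (Next.κ⁻¹κ y))) c-prefers-x
        passes : ∀ μ → SM μ → ρ' ∈ds μ → rA y (κ y) ℕ.< rA y (μ y)
        passes μ sμ ρ'∈μ with rA y (κ y) ℕ.<? rA y (μ y)
        ... | yes p = p
        ... | no ¬p = ⊥-elim (proj₂ (⊔-stable sμ sκ) x y (x-covets , c-prefers-x′))
          where
          ξ = μ ⊔ κ
          ξy≡c : ξ y ≡ c
          ξy≡c = trans (⊔-≡ʳ μ κ y (ℕP.≮⇒≥ ¬p)) κy≡c
          ξx≡μx : ξ x ≡ μ x
          ξx≡μx = ⊔-≡ˡ μ κ x
                    (subst (λ w → rA x w ℕ.≤ rA x (μ x)) (sym (ρ'-in-κ j)) (ℕP.<⇒≤ (ρ'∈μ j)))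
          x-covets : rA x (ξ y) ℕ.< rA x (ξ x)
          x-covets = subst₂ (λ w v → rA x w ℕ.< rA x v) (sym ξy≡c) (sym ξx≡μx)
            (ℕP.<-≤-trans c-earlier (next-first' j (μ x) (μ , sμ , refl) (ρ'∈μ j)))
          c-prefers-x′ : rB (ξ y) x ℕ.< rB (ξ y) y
          c-prefers-x′ = subst (λ w → rB w x ℕ.< rB w y) (sym ξy≡c) c-prefers-x

      no-earlier-willing : (∀ j c → Willing (as' j) c → ¬ rA (as' j) c ℕ.< rA (as' j) (bs' (csuc j))) →
                           ⊥
      no-earlier-willing none =
        ℕP.<-irrefl (cong (rA a₀) (sym (κ'≡κ-on-ρ' F.zero))) (κ'-advances a₀-onCycle)
        where
        a₀ = as' F.zero
        firstWilling-κ : ∀ j → FirstWilling (as' j) (bs' (csuc j))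
        firstWilling-κ j = (later , prefers) , λ c w → ℕP.≮⇒≥ (none j c w)
          where
          later = subst (λ w → rA (as' j) w ℕ.< rA (as' j) (bs' (csuc j))) (κ'≡κ-on-ρ' j)
                    (proj₁ (proj₁ (firstWilling' j)))
          prefers = subst (λ z → rB (bs' (csuc j)) (as' j) ℕ.< rB (bs' (csuc j)) z)
                          (sym (κ⁻¹≡κ'⁻¹-on-ρ' (csuc j))) (proj₂ (proj₁ (firstWilling' j)))
        next-as' : ∀ j → next (as' j) ≡ as' (csuc j)
        next-as' j = trans (next-firstWilling (firstWilling-κ j))
                           (trans (cong κ⁻¹ (sym (ρ'-in-κ (csuc j)))) (κ⁻¹κ (as' (csuc j))))
        k'<n = rotation-length≤n ρ'
        a₀-onCycle : OnCycle a₀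
        a₀-onCycle = (_ , proj₁ (firstWilling-κ F.zero)) , fromℕ< k'<n ,
          subst (λ t → fold a₀ next (suc t) ≡ a₀) (sym (FP.toℕ-fromℕ< k'<n))
                (fold-around next as' next-as')

      unmoved : HasPredecessor
      unmoved
        with any? (λ j → any? (λ c → willing? (as' j) c ×-dec rA (as' j) c ℕ.<? rA (as' j) (bs' (csuc j))))
      ... | yes (j , c , w , earlier) = earlier-willing j c w earlier
      ... | no none = ⊥-elim (no-earlier-willing (λ j c w earlier → none (j , c , w , earlier)))

    predecessor : HasPredecessor
    predecessor with any? (λ j → ¬? (κ (as' j) FP.≟ bs' j))
    ... | yes (j , κx≢b) = moved-on-ρ' j κx≢b
    ... | no none-moved =
      unmoved (λ j → decidable-stable (κ (as' j) FP.≟ bs' j) (λ κx≢b → none-moved (j , κx≢b)))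

  module GaleShapley where

    womanAt : Fin n → Fin n → Fin n
    womanAt a = inverse (rankA a) (rankA-inj a)

    rankA-womanAt : ∀ a r → rankA a (womanAt a r) ≡ r
    rankA-womanAt a = inverseʳ (rankA a) (rankA-inj a)

    womanAt-rankA : ∀ a w → womanAt a (rankA a w) ≡ w
    womanAt-rankA a = inverseˡ (rankA a) (rankA-inj a)

    module Round (p : Fin n → Fin n) where

      proposal : Matching I
      proposal a = womanAt a (p a)

      rA-proposal : ∀ a → rA a (proposal a) ≡ toℕ (p a)
      rA-proposal a = cong toℕ (rankA-womanAt a (p a))

      Invariant : Set
      Invariant = ∀ a w → rA a w ℕ.< toℕ (p a) → ∃ λ x → proposal x ≡ w × rB w x ℕ.< rB w a

      Rejected : Fin n → Set
      Rejected a = ∃ λ x → proposal x ≡ proposal a × rB (proposal a) x ℕ.< rB (proposal a) a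

      rejected? : ∀ a → Dec (Rejected a)
      rejected? a = any? (λ x → proposal x FP.≟ proposal a ×-dec rB (proposal a) x ℕ.<? rB (proposal a) a)

      measure : ℕ
      measure = sumᶠ (toℕ ∘ p)

      measure≤n*n : measure ℕ.≤ n * n
      measure≤n*n = sumᶠ-≤-* (λ a → ℕP.<⇒≤ (FP.toℕ<n (p a)))

      module _ (invariant : Invariant) (none : ∀ a → ¬ Rejected a) where

        proposal-injective : Injective _≡_ _≡_ proposal
        proposal-injective {x} {y} eq with ℕP.<-cmp (rB (proposal x) x) (rB (proposal x) y)
        ... | tri< x-preferred _ _ = ⊥-elim (none y (x , eq , subst (λ w → rB w x ℕ.< rB w y) eq x-preferred))
        ... | tri≈ _ same _        = rB-injective (proposal x) same
        ... | tri> _ _ y-preferred = ⊥-elim (none x (y , sym eq , y-preferred))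

        proposal-stable : SM proposal
        proposal-stable = proposal-injective , unblocked
          where
          unblocked : Stable I proposal
          unblocked x y (x-covets , x-preferred)
            with z , same , z-preferred ←
                   invariant x (proposal y) (subst (rA x (proposal y) ℕ.<_) (rA-proposal x) x-covets)
            rewrite proposal-injective same = ℕP.<-asym x-preferred z-preferred

      -- Otherwise every woman would hold a proposal from a man other than a: an injection of all the
      -- women into the remaining men.
      rejected⇒not-last : Invariant → ∀ {a} → Rejected a → suc (toℕ (p a)) ℕ.< n
      rejected⇒not-last invariant {a} (x₀ , same , x₀-preferred) with suc (toℕ (p a)) ℕ.<? n
      ... | yes not-last = not-last
      ... | no last = ⊥-elim (holder≢a (inverseʳ holder holder-injective a))
        where
        rival : ∀ w → ∃ λ x → proposal x ≡ w × rB w x ℕ.< rB w a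
        rival w
          with ℕP.m≤n⇒m<n∨m≡n (ℕP.≤-pred (ℕP.≤-trans (FP.toℕ<n (rankA a w)) (ℕP.≮⇒≥ last)))
        ... | inj₁ before = invariant a w before
        ... | inj₂ at = x₀ , trans same w≡ , subst (λ v → rB v x₀ ℕ.< rB v a) w≡ x₀-preferred
          where
          w≡ : proposal a ≡ w
          w≡ = trans (cong (womanAt a) (toℕ-injective (sym at))) (womanAt-rankA a w)
        holder : Fin n → Fin n
        holder w = proj₁ (rival w)
        holder-injective : Injective _≡_ _≡_ holder
        holder-injective {w} {w'} eq =
          trans (sym (proj₁ (proj₂ (rival w)))) (trans (cong proposal eq) (proj₁ (proj₂ (rival w'))))
        holder≢a : ∀ {w} → holder w ≢ a
        holder≢a {w} eq = ℕP.<-irrefl (cong (rB w) eq) (proj₂ (proj₂ (rival w)))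

    module Step (p : Fin n → Fin n) (invariant : Round.Invariant p) {a} (rejected : Round.Rejected p a) where
      open Round p

      p' : Fin n → Fin n
      p' = V.updateAt p a (λ _ → fromℕ< (rejected⇒not-last invariant rejected))

      p'-a : toℕ (p' a) ≡ suc (toℕ (p a))
      p'-a = trans (cong toℕ (VP.updateAt-updates a p)) (FP.toℕ-fromℕ< _)

      p'-others : ∀ {x} → x ≢ a → p' x ≡ p x
      p'-others x≢a = VP.updateAt-minimal _ a p x≢a

      x₀ = proj₁ rejected

      x₀-holds : proposal x₀ ≡ proposal a
      x₀-holds = proj₁ (proj₂ rejected)

      x₀-preferred : rB (proposal a) x₀ ℕ.< rB (proposal a) a
      x₀-preferred = proj₂ (proj₂ rejected)

      holder-kept : ∀ {x w b} → proposal x ≡ w → rB w x ℕ.< rB w b →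
                    ∃ λ x' → Round.proposal p' x' ≡ w × rB w x' ℕ.< rB w b
      holder-kept {x} {w} {b} holds x-preferred with x FP.≟ a
      ... | no x≢a = x , trans (cong (womanAt x) (p'-others x≢a)) holds , x-preferred
      ... | yes refl =
        x₀ , trans (cong (womanAt x₀) (p'-others x₀≢a)) (trans x₀-holds holds) ,
        ℕP.<-trans (subst (λ v → rB v x₀ ℕ.< rB v a) holds x₀-preferred) x-preferred
        where
        x₀≢a : x₀ ≢ a
        x₀≢a x₀≡a = ℕP.<-irrefl (cong (rB (proposal a)) x₀≡a) x₀-preferred

      invariant' : Round.Invariant p'
      invariant' b w before with b FP.≟ a
      ... | no b≢a
        with x , holds , preferred ← invariant b w (subst (rA b w ℕ.<_) (cong toℕ (p'-others b≢a)) before) =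
        holder-kept holds preferred
      ... | yes refl with ℕP.m≤n⇒m<n∨m≡n (ℕP.≤-pred (subst (rA a w ℕ.<_) p'-a before))
      ...   | inj₁ earlier with x , holds , preferred ← invariant a w earlier = holder-kept holds preferred
      ...   | inj₂ at =
        holder-kept (trans x₀-holds w≡) (subst (λ v → rB v x₀ ℕ.< rB v a) w≡ x₀-preferred)
        where
        w≡ : proposal a ≡ w
        w≡ = trans (cong (womanAt a) (toℕ-injective (sym at))) (womanAt-rankA a w)

      measure-increases : measure ℕ.< Round.measure p'
      measure-increases = sumᶠ-mono-< p≤p' a (ℕP.≤-reflexive (sym p'-a))
        where
        p≤p' : ∀ x → toℕ (p x) ℕ.≤ toℕ (p' x)
        p≤p' x with x FP.≟ a
        ... | yes refl = ℕP.≤-trans (ℕP.n≤1+n _) (ℕP.≤-reflexive (sym p'-a))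
        ... | no x≢a   = ℕP.≤-reflexive (cong toℕ (sym (p'-others x≢a)))

    run : ∀ p → Round.Invariant p → Acc ℕ._<_ (n * n ∸ Round.measure p) → ∃ SM
    run p invariant (acc smaller) with any? (Round.rejected? p)
    ... | no none = Round.proposal p , Round.proposal-stable p invariant (λ a r → none (a , r))
    ... | yes (a , rejected) =
      run p' invariant' (smaller (ℕP.∸-monoʳ-< measure-increases (Round.measure≤n*n p')))
      where open Step p invariant rejected

    stableMatching : ∃ SM
    stableMatching =
      run p₀ (λ a w before → ⊥-elim (ℕP.n≮0 (subst (rA a w ℕ.<_) (FP.toℕ-fromℕ< _) before)))
             (<-wellFounded _)
      where
      p₀ : Fin n → Fin n
      p₀ a = fromℕ< (ℕP.≤-<-trans z≤n (FP.toℕ<n a))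

  ⊑? : ∀ μ ν → Dec (μ ⊑ ν)
  ⊑? μ ν = all? (λ a → rA a (μ a) ℕ.≤? rA a (ν a))

  manOptimal : ∃ λ μ → SM μ × ∀ ν → SM ν → μ ⊑ ν
  manOptimal = descend (proj₂ GaleShapley.stableMatching) (<-wellFounded _)
    where
    descend : ∀ {μ} → SM μ → Acc ℕ._<_ (rankSum μ) → ∃ λ μ → SM μ × ∀ ν → SM ν → μ ⊑ ν
    descend {μ} sμ (acc smaller) with any-function? (λ ξ → SM ξ × ¬ μ ⊑ ξ)
        (λ μ≗ν → Prod.map (SM-resp-≗ μ≗ν)
                   (λ μ⋢ξ μ⊑ν → μ⋢ξ (λ a → subst (λ w → rA a (μ a) ℕ.≤ rA a w) (sym (μ≗ν a)) (μ⊑ν a))))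
        (λ ξ → SM? ξ ×-dec ¬? (⊑? μ ξ))
    ... | no none = μ , sμ , λ ν sν → decidable-stable (⊑? μ ν) (λ μ⋢ν → none (ν , sν , μ⋢ν))
    ... | yes (ξ , sξ , μ⋢ξ) with any? (λ a → ¬? (rA a (μ a) ℕ.≤? rA a (ξ a)))
    ...   | yes (a , worse) = descend (⊓-stable sμ sξ)
            (smaller (sumᶠ-mono-< (⊓-lowerˡ μ ξ) a (ℕP.≤-<-trans (⊓-lowerʳ μ ξ a) (ℕP.≰⇒> worse))))
    ...   | no none =
      ⊥-elim (μ⋢ξ (λ a → decidable-stable (rA a (μ a) ℕ.≤? rA a (ξ a)) (λ worse → none (a , worse))))

  nonempty-prefixes : ∀ L {S} → Nonempty I (applySeq I L S) → AllNonempty I S L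
  nonempty-prefixes []      nonempty        = nonempty
  nonempty-prefixes (ρ ∷ L) (μ , in-result) =
    (μ , proj₁ (applySeq-⊆ L in-result)) , nonempty-prefixes L (μ , in-result)
    where
    applySeq-⊆ : ∀ L {S μ} → applySeq I L S μ → S μ
    applySeq-⊆ []      in-S = in-S
    applySeq-⊆ (ρ ∷ L) in-L = proj₁ (applySeq-⊆ L in-L)

  record Layering {κ} (sκ : SM κ) : Set₁ where
    field
      layers       : List (List (Rotation I))
      valid        : ∀ S → S ≐ Up κ → Singleton I (applySeq I (concat layers) S) × LayersOK I S layers
      chain        : List (Rotation I)
      chain-linked : IsChain I chain
      chain-length : length chain ≡ length layers
      -- so that the layering one step earlier can prepend a predecessor from its own layer
      chain-head   : chain ≡ [] ⊎ Σ (AtMatching.ExposedRotation sκ) λ e →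
                       ∃ λ rest → chain ≡ AtMatching.ExposedRotation.ρ e ∷ rest

  greedy : ∀ {κ} (sκ : SM κ) → Acc ℕ._<_ (n * n ∸ rankSum κ) → Layering sκ
  greedy {κ} sκ (acc smaller) with any? (AtMatching.onCycle? sκ)
  ... | no none = record
    { layers = []
    ; valid = λ S S≐Up →
        (κ , proj₂ (S≐Up κ) (sκ , ⊑-refl) , λ ν Sν → stuck (λ a c → none (a , c)) (proj₁ (S≐Up ν) Sν)) , _
    ; chain = [] ; chain-linked = [] ; chain-length = refl ; chain-head = inj₁ refl }
    where open AtMatching sκ
  ... | yes (a , c) = record
    { layers = layerRotations ∷ layers ; valid = valid′
    ; chain = ρ (proj₁ extended) ∷ chain ; chain-linked = proj₂ extended ; chain-length = cong suc chain-length
    ; chain-head = inj₂ (proj₁ extended , chain , refl) }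
    where
    open AtMatching sκ
    open ExposedRotation using (ρ)
    rest : Layering κ'-stable
    rest = greedy κ'-stable (smaller (ℕP.∸-monoʳ-< (progress c) (rankSum≤n*n κ')))
    open Layering rest
    valid′ : ∀ S → S ≐ Up κ → Singleton I (applySeq I (concat (layerRotations ∷ layers)) S) ×
                              LayersOK I S (layerRotations ∷ layers)
    valid′ S S≐Up
      with single , ok ← valid (applySeq I layerRotations S) (applyLayer layerRotations S≐Up ↭-refl) =
      subst (Singleton I) (sym (applySeq-++ layerRotations (concat layers) S)) single ,
      (λ L reorder → ≐-trans (applyLayer L S≐Up reorder) (≐-sym (applyLayer layerRotations S≐Up ↭-refl))) ,
      ok
    extended : Σ ExposedRotation λ e → IsChain I (ρ e ∷ chain)
    extended with chain-head
    ... | inj₁ empty = proj₁ (eliminate c) , subst (λ ch → IsChain I (_ ∷ ch)) (sym empty) [-]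
    ... | inj₂ (e' , _ , starts-e') with e , _ , e≺e' ← LayerPredecessor.predecessor sκ e' =
      e , subst (λ ch → IsChain I (ρ e ∷ ch)) (sym starts-e')
                (e≺e' ∷ subst (IsChain I) starts-e' chain-linked)

  layering⇒height≡depth : ∀ {μ₀} {sμ₀ : SM μ₀} → (∀ ν → SM ν → μ₀ ⊑ ν) → Layering sμ₀ →
                          Σ ℕ (λ h → IsHeight I h × IsDepth I h)
  layering⇒height≡depth {μ₀} optimal layering = length chain ,
    ((chain , chain-linked , refl) ,
     λ c c-linked → subst (length c ℕ.≤_) (sym chain-length) (chain≤depth c layers c-linked layers-valid)) ,
    ((layers , layers-valid , sym chain-length) ,
     λ Ls Ls-valid → chain≤depth chain Ls chain-linked Ls-valid)
    where
    open Layering layering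
    spec≐Up : SpecSM I ≐ Up μ₀
    spec≐Up μ = (λ sμ → sμ , optimal μ sμ) , proj₁
    layers-valid : ValidLayering I layers
    layers-valid with single , ok ← valid (SpecSM I) spec≐Up =
      nonempty-prefixes (concat layers) (proj₁ single , proj₁ (proj₂ single)) , single , ok

mainTheorem12 : (I : SMInstance) → Σ ℕ (λ h → IsHeight I h × IsDepth I h)
mainTheorem12 I with μ₀ , sμ₀ , optimal ← manOptimal I =
  layering⇒height≡depth I optimal (greedy I sμ₀ (<-wellFounded _))
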